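{- Let $p$ be an odd prime, $n \geq 1$ an integer, $q = p^n$, and let $b \in \mathbb{F}_q^\times$ satisfy \[ \mathrm{Nr}_{\mathbb{F}_q/\mathbb{F}_p}(b) = b^{(p^n-1)/(p-1)} = (-1)^{n+1}. \] Then $\#\{x \in \mathbb{F}_{q^2} : x^p + bx \in \mathbb{F}_q\} = p^{n+1} = p\cdot q$. -}

module Defs where

open import Level using (0ℓ)
open import Data.Nat as ℕ using (ℕ; zero; suc; NonZero; _∸_)
open import Data.Nat.DivMod using (_/_)
open import Data.Nat.Primality using (Prime)
open import Data.Fin using (Fin)
open import Data.Product using (∃)
open import Function.Bundles using (_↔_)
open import Relation.Nullary using (¬_)
open import Relation.Binary.PropositionalEquality using (_≡_)
open import Algebra.Structures using (IsCommutativeRing)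

record FiniteField (m : ℕ) : Set₁ where
  infixl 6 _+_
  infixl 7 _*_
  field
    Carrier : Set
    _+_ _*_ : Carrier → Carrier → Carrier
    -_      : Carrier → Carrier
    0# 1#   : Carrier
    isCommutativeRing : IsCommutativeRing _≡_ _+_ _*_ -_ 0# 1#
    0≢1     : ¬ (0# ≡ 1#)
    inverse : ∀ x → ¬ (x ≡ 0#) → ∃ λ y → x * y ≡ 1#
    card    : Carrier ↔ Fin m

  pow : Carrier → ℕ → Carrier
  pow x zero    = 1#
  pow x (suc k) = x * pow x k

open FiniteField public

record FieldEmbedding {m m' : ℕ} (K : FiniteField m) (L : FiniteField m') : Set where
  field
    ι       : Carrier K → Carrier L
    ι-+     : ∀ x y → ι (_+_ K x y) ≡ _+_ L (ι x) (ι y)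
    ι-*     : ∀ x y → ι (_*_ K x y) ≡ _*_ L (ι x) (ι y)
    ι-1     : ι (1# K) ≡ 1# L
    ι-inj   : ∀ x y → ι x ≡ ι y → x ≡ y

open FieldEmbedding public

prime⇒p∸1≢0 : ∀ {p} → Prime p → NonZero (p ∸ 1)
prime⇒p∸1≢0 {suc (suc k)} _ = _

normExp : (p n : ℕ) → Prime p → ℕ
normExp p n pr = ((p ℕ.^ n) ∸ 1) / (p ∸ 1)
  where instance _ = prime⇒p∸1≢0 pr

module Submission where

-- Let q = p ^ n, s = p - 1, β = ι b and f x = x ^ p + β * x. In characteristic p both f and ℘ x = x ^ q - x
-- are additive on L, and they commute because β ∈ K is fixed by x ↦ x ^ q. The kernel of ℘ is K, so x is a
-- solution iff f (℘ x) = 0, and as the fibres of ℘ are translates of its kernel there are q · #(ker f ∩ im ℘)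
-- solutions. The image of ℘ is {z ∣ z ^ q = - z}: it lies in that set and has q² / q elements. The norm
-- condition gives (- β) ^ ((q - 1) / s) = - 1, so every nonzero root z of f, having z ^ s = - β, satisfies
-- z ^ q = - z; thus ker f ⊆ im ℘. Finally # ker f = p: f has degree p, and its p roots are c z₀ (c ∈ 𝔽ₚ) for any
-- z₀ with z₀ ^ s = - β. Such z₀ exists: the (q² - 1) / s distinct s-th powers in L× are roots of
-- w ^ ((q² - 1) / s) = 1, hence they are all its roots, and (- β) ^ ((q² - 1) / s) = 1.

open import Level using (Level)
open import Data.Nat.Base as ℕ using (ℕ; suc; _≤_)
open import Data.Nat.Primality using (Prime)
open import Algebra.Bundles using (CommutativeRing)
open import Relation.Binary.PropositionalEquality using (_≡_)
open import Defs using (FiniteField; module FiniteField; FieldEmbedding; module FieldEmbedding; normExp; prime⇒p∸1≢0)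

module Counting where

  open import Level using (0ℓ)
  open import Data.Nat.Base using (ℕ; zero; suc; _+_; _*_; _≤_; _<_; z≤n; s≤s)
  import Data.Nat.Properties as ℕₚ
  open import Data.Fin.Base using (Fin; zero; suc)
  import Data.Fin.Properties as Fin
  open import Data.Fin.Permutation using (Permutation)
  open import Data.Product.Base using (Σ; ∃; _×_; _,_; proj₁)
  open import Data.Sum.Base using (_⊎_; inj₁; inj₂)
  open import Data.Sum.Function.Propositional using (_⊎-↔_)
  open import Data.Empty using (⊥-elim)
  open import Function.Base using (_∘_)
  open import Function.Bundles using (_↔_; Inverse; mk↔ₛ′)
  open import Function.Construct.Composition using (_↔-∘_)
  open import Function.Construct.Symmetry using (↔-sym)
  open import Function.Definitions using (Injective)
  open import Data.Product.Function.Dependent.Propositional using (Σ-↔)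
  open import Relation.Nullary using (Dec; yes; no; ¬_; _×-dec_; _⊎-dec_)
  import Relation.Nullary.Decidable as Dec
  open import Relation.Unary
    using (Pred; Decidable; _⊆_; _≐_; _∩_; _∪_; ｛_｝; Universal; Empty)
  open import Relation.Unary.Properties using (_∩?_; _∪?_)
  open import Relation.Binary.Definitions using (DecidableEquality)
  open import Relation.Binary.PropositionalEquality
    using (_≡_; refl; sym; trans; cong; cong₂; subst; module ≡-Reasoning)
  open import Algebra.Bundles using (CommutativeMonoid)
  open import Algebra.Properties.Semiring.Sum ℕₚ.+-*-semiring
    using (sum; ∑-comm; ∑-distrib-+; *-distribˡ-sum; *-distribʳ-sum; sum-cong-≗)

  indicator : {P : Set} → Dec P → ℕ
  indicator (yes _) = 1
  indicator (no _)  = 0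

  indicator-mono : {P Q : Set} → (P → Q) → (P? : Dec P) (Q? : Dec Q) → indicator P? ≤ indicator Q?
  indicator-mono P⇒Q (yes p) (yes _) = ℕₚ.≤-refl
  indicator-mono P⇒Q (yes p) (no ¬q) = ⊥-elim (¬q (P⇒Q p))
  indicator-mono P⇒Q (no _)  Q?      = z≤n

  indicator-cong : {P Q : Set} → (P → Q) → (Q → P) → (P? : Dec P) (Q? : Dec Q) → indicator P? ≡ indicator Q?
  indicator-cong P⇒Q Q⇒P P? Q? = ℕₚ.≤-antisym (indicator-mono P⇒Q P? Q?) (indicator-mono Q⇒P Q? P?)

  indicator-× : {P Q : Set} (P? : Dec P) (Q? : Dec Q) →
                indicator (P? ×-dec Q?) ≡ indicator P? * indicator Q?
  indicator-× (yes _) (yes _) = refl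
  indicator-× (yes _) (no _)  = refl
  indicator-× (no _)  Q?      = refl

  indicator-⊎ : {P Q : Set} (P? : Dec P) (Q? : Dec Q) →
                indicator (P? ⊎-dec Q?) ≤ indicator P? + indicator Q?
  indicator-⊎ (yes _) Q?      = s≤s z≤n
  indicator-⊎ (no _)  (yes _) = ℕₚ.≤-refl
  indicator-⊎ (no _)  (no _)  = z≤n

  indicator-⊎-disjoint : {P Q : Set} → ¬ (P × Q) → (P? : Dec P) (Q? : Dec Q) →
                         indicator (P? ⊎-dec Q?) ≡ indicator P? + indicator Q?
  indicator-⊎-disjoint disj (yes p) (yes q) = ⊥-elim (disj (p , q))
  indicator-⊎-disjoint disj (yes _) (no _)  = refl
  indicator-⊎-disjoint disj (no _)  (yes _) = refl
  indicator-⊎-disjoint disj (no _)  (no _)  = refl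

  irrelevant↔indicator : {P : Set} → (∀ (p q : P) → p ≡ q) → (P? : Dec P) → P ↔ Fin (indicator P?)
  irrelevant↔indicator irr (yes p) = mk↔ₛ′ (λ _ → zero) (λ _ → p) (λ { zero → refl }) (irr p)
  irrelevant↔indicator irr (no ¬p) = mk↔ₛ′ (⊥-elim ∘ ¬p) (λ ()) (λ ()) (⊥-elim ∘ ¬p)

  sum-mono : ∀ {n} {f g : Fin n → ℕ} → (∀ i → f i ≤ g i) → sum f ≤ sum g
  sum-mono {zero}  f≤g = z≤n
  sum-mono {suc n} f≤g = ℕₚ.+-mono-≤ (f≤g zero) (sum-mono (f≤g ∘ suc))

  sum-indicator-empty : ∀ {n} {P : Pred (Fin n) 0ℓ} (P? : Decidable P) → Empty P → sum (indicator ∘ P?) ≡ 0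
  sum-indicator-empty {zero}  P? ∉P = refl
  sum-indicator-empty {suc n} P? ∉P with P? zero
  ... | yes p = ⊥-elim (∉P zero p)
  ... | no _  = sum-indicator-empty (P? ∘ suc) (∉P ∘ suc)

  sum-indicator-universal : ∀ {n} {P : Pred (Fin n) 0ℓ} (P? : Decidable P) → Universal P → sum (indicator ∘ P?) ≡ n
  sum-indicator-universal {zero}  P? ∈P = refl
  sum-indicator-universal {suc n} P? ∈P with P? zero
  ... | yes _ = cong suc (sum-indicator-universal (P? ∘ suc) (∈P ∘ suc))
  ... | no ∉P = ⊥-elim (∉P (∈P zero))

  sum-indicator-≡ : ∀ {n} (j : Fin n) → sum (indicator ∘ (j Fin.≟_)) ≡ 1
  sum-indicator-≡ {suc n} zero = cong suc (sum-indicator-empty {n} ((zero Fin.≟_) ∘ suc) (λ _ ()))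
  sum-indicator-≡ (suc j) = trans (sum-cong-≗ (λ i → indicator-cong Fin.suc-injective (cong suc) (suc j Fin.≟ suc i) (j Fin.≟ i)))
                                  (sum-indicator-≡ j)

  Σ-Fin-suc↔⊎ : ∀ {n} {P : Pred (Fin (suc n)) 0ℓ} → Σ (Fin (suc n)) P ↔ (P zero ⊎ Σ (Fin n) (P ∘ suc))
  Σ-Fin-suc↔⊎ = mk↔ₛ′ (λ { (zero , p) → inj₁ p ; (suc i , p) → inj₂ (i , p) })
                      (λ { (inj₁ p) → zero , p ; (inj₂ (i , p)) → suc i , p })
                      (λ { (inj₁ p) → refl ; (inj₂ (i , p)) → refl })
                      (λ { (zero , p) → refl ; (suc i , p) → refl })

  Σ-Fin↔sum-indicator : ∀ {n} {P : Pred (Fin n) 0ℓ} (P? : Decidable P) → (∀ i (p q : P i) → p ≡ q) →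
                        Σ (Fin n) P ↔ Fin (sum (indicator ∘ P?))
  Σ-Fin↔sum-indicator {zero}  P? irr = mk↔ₛ′ (λ { (() , _) }) (λ ()) (λ ()) (λ { (() , _) })
  Σ-Fin↔sum-indicator {suc n} P? irr =
    ↔-sym Fin.+↔⊎ ↔-∘ ((irrelevant↔indicator (irr zero) (P? zero) ⊎-↔ Σ-Fin↔sum-indicator (P? ∘ suc) (irr ∘ suc)) ↔-∘ Σ-Fin-suc↔⊎)

  module FiniteSum {A : Set} {m : ℕ} (enum : A ↔ Fin m) {ℓ} (M : CommutativeMonoid 0ℓ ℓ) where
    open Inverse enum using (to; from; strictlyInverseʳ)
    open CommutativeMonoid M using (Carrier; _≈_; _∙_; ε; setoid; monoid; ∙-congˡ)
      renaming (refl to ≈-refl; sym to ≈-sym)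
    open import Algebra.Properties.CommutativeMonoid.Sum M as MonoidSum using ()
    open import Algebra.Properties.Monoid.Mult monoid using (×-homo-+) renaming (_×_ to _×ₘ_)
    open import Relation.Binary.Reasoning.Setoid setoid

    ∑ : (A → Carrier) → Carrier
    ∑ h = MonoidSum.sum (h ∘ from)

    ∑-cong : {h k : A → Carrier} → (∀ x → h x ≡ k x) → ∑ h ≡ ∑ k
    ∑-cong h≗k = MonoidSum.sum-cong-≗ (h≗k ∘ from)

    ∑-distrib : (h k : A → Carrier) → ∑ (λ x → h x ∙ k x) ≈ ∑ h ∙ ∑ k
    ∑-distrib h k = MonoidSum.∑-distrib-+ (h ∘ from) (k ∘ from)

    ∑-permute : (τ : A ↔ A) (h : A → Carrier) → ∑ (h ∘ Inverse.to τ) ≈ ∑ h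
    ∑-permute τ h = ≈-sym (begin
      MonoidSum.sum (h ∘ from)                    ≈⟨ MonoidSum.∑-permute (h ∘ from) π ⟩
      MonoidSum.sum (h ∘ from ∘ to ∘ τ.to ∘ from) ≡⟨ MonoidSum.sum-cong-≗ (cong h ∘ strictlyInverseʳ ∘ τ.to ∘ from) ⟩
      MonoidSum.sum (h ∘ τ.to ∘ from)             ∎)
      where
      module τ = Inverse τ
      π : Permutation m m
      π = enum ↔-∘ (τ ↔-∘ ↔-sym enum)

    ∑-× : (f : A → ℕ) (a : Carrier) → ∑ (λ x → f x ×ₘ a) ≈ sum (f ∘ from) ×ₘ a
    ∑-× f a = go (f ∘ from)
      where
      go : ∀ {n} (g : Fin n → ℕ) → MonoidSum.sum (λ i → g i ×ₘ a) ≈ sum g ×ₘ a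
      go {zero}  g = ≈-refl
      go {suc n} g = begin
        g zero ×ₘ a ∙ MonoidSum.sum (λ i → g (suc i) ×ₘ a) ≈⟨ ∙-congˡ (go (g ∘ suc)) ⟩
        g zero ×ₘ a ∙ sum (g ∘ suc) ×ₘ a                   ≈⟨ ×-homo-+ a (g zero) (sum (g ∘ suc)) ⟨
        (g zero + sum (g ∘ suc)) ×ₘ a                     ∎

    ∑-preserves : (Q : Pred Carrier 0ℓ) → Q ε → (∀ {x y} → Q x → Q y → Q (x ∙ y)) →
                  (h : A → Carrier) → (∀ x → Q (h x)) → Q (∑ h)
    ∑-preserves Q Qε Q∙ h Qh = go (h ∘ from) (Qh ∘ from)
      where
      go : ∀ {n} (g : Fin n → Carrier) → (∀ i → Q (g i)) → Q (MonoidSum.sum g)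
      go {zero}  g Qg = Qε
      go {suc n} g Qg = Q∙ (Qg zero) (go (g ∘ suc) (Qg ∘ suc))

  module Enumerated {A : Set} {m : ℕ} (enum : A ↔ Fin m) where
    open Inverse enum using (to; from; strictlyInverseˡ; strictlyInverseʳ)
    open FiniteSum enum ℕₚ.+-0-commutativeMonoid using (∑; ∑-cong; ∑-permute)

    infix 4 _≟_
    _≟_ : DecidableEquality A
    x ≟ y = Dec.map′ to-injective (cong to) (to x Fin.≟ to y)
      where
      to-injective : to x ≡ to y → x ≡ y
      to-injective eq = trans (sym (strictlyInverseʳ x)) (trans (cong from eq) (strictlyInverseʳ y))

    ∃? : {P : Pred A 0ℓ} → Decidable P → Dec (∃ P)
    ∃? {P} P? = Dec.map′ (λ (i , p) → from i , p)
                         (λ (x , p) → to x , subst P (sym (strictlyInverseʳ x)) p)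
                         (Fin.any? (P? ∘ from))

    count : {P : Pred A 0ℓ} → Decidable P → ℕ
    count P? = ∑ (indicator ∘ P?)

    module _ {P Q : Pred A 0ℓ} (P? : Decidable P) (Q? : Decidable Q) where

      count-mono : P ⊆ Q → count P? ≤ count Q?
      count-mono P⊆Q = sum-mono (λ i → indicator-mono P⊆Q (P? (from i)) (Q? (from i)))

      count-cong : P ≐ Q → count P? ≡ count Q?
      count-cong (P⊆Q , Q⊆P) = sum-cong-≗ (λ i → indicator-cong P⊆Q Q⊆P (P? (from i)) (Q? (from i)))

      count-∪ : count (P? ∪? Q?) ≤ count P? + count Q?
      count-∪ = ℕₚ.≤-trans (sum-mono (λ i → indicator-⊎ (P? (from i)) (Q? (from i))))
                          (ℕₚ.≤-reflexive (∑-distrib-+ (indicator ∘ P? ∘ from) (indicator ∘ Q? ∘ from)))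

      count-∪-disjoint : Empty (P ∩ Q) → count (P? ∪? Q?) ≡ count P? + count Q?
      count-∪-disjoint disj = trans (sum-cong-≗ (λ i → indicator-⊎-disjoint (disj (from i)) (P? (from i)) (Q? (from i))))
                                    (∑-distrib-+ (indicator ∘ P? ∘ from) (indicator ∘ Q? ∘ from))

      count-permute : (τ : A ↔ A) → (P ∘ Inverse.to τ) ≐ Q → count P? ≡ count Q?
      count-permute τ (Pτ⊆Q , Q⊆Pτ) = begin
        count P?                     ≡⟨ ∑-permute τ (indicator ∘ P?) ⟨
        ∑ (indicator ∘ P? ∘ τ.to)    ≡⟨ sum-cong-≗ (λ i → indicator-cong Pτ⊆Q Q⊆Pτ (P? (τ.to (from i))) (Q? (from i))) ⟩
        count Q?                     ∎
        where
        module τ = Inverse τ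
        open ≡-Reasoning

    count-singleton : ∀ a → count (a ≟_) ≡ 1
    count-singleton a = trans (sum-cong-≗ (λ i → indicator-cong (λ a≡ → trans (cong to a≡) (strictlyInverseˡ i))
                                                                 (λ to≡ → trans (sym (strictlyInverseʳ a)) (cong from to≡))
                                                                 (a ≟ from i) (to a Fin.≟ i)))
                              (sum-indicator-≡ (to a))

    module _ {P : Pred A 0ℓ} (P? : Decidable P) where

      count-empty : Empty P → count P? ≡ 0
      count-empty ∉P = sum-indicator-empty (P? ∘ from) (∉P ∘ from)

      count-universal : Universal P → count P? ≡ m
      count-universal ∈P = sum-indicator-universal (P? ∘ from) (∈P ∘ from)

      Σ↔count : (∀ x (p q : P x) → p ≡ q) → Σ A P ↔ Fin (count P?)
      Σ↔count irr = Σ-Fin↔sum-indicator (P? ∘ from) (irr ∘ from) ↔-∘ Σ-↔ enum transport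
        where
        transport : ∀ {x} → P x ↔ P (from (to x))
        transport {x} = mk↔ₛ′ (subst P (sym (strictlyInverseʳ x))) (subst P (strictlyInverseʳ x))
                              (λ _ → irr _ _ _) (λ _ → irr _ _ _)

    count-singleton-∩ : ∀ {P : Pred A 0ℓ} (P? : Decidable P) a → count ((a ≟_) ∩? P?) ≡ indicator (P? a)
    count-singleton-∩ P? a with P? a
    ... | yes p = trans (count-cong ((a ≟_) ∩? P?) (a ≟_) (proj₁ , λ { refl → refl , p })) (count-singleton a)
    ... | no ¬p = count-empty ((a ≟_) ∩? P?) (λ { x (refl , p) → ¬p p })

    module _ {P Q : Pred A 0ℓ} (P? : Decidable P) (Q? : Decidable Q) where

      count-≤⇒⊇ : P ⊆ Q → count Q? ≤ count P? → Q ⊆ P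
      count-≤⇒⊇ P⊆Q Q≤P {x} q with P? x
      ... | yes p = p
      ... | no ¬p = ⊥-elim (ℕₚ.<-irrefl refl (ℕₚ.<-≤-trans P<Q Q≤P))
        where
        open ℕₚ.≤-Reasoning
        P<Q : count P? < count Q?
        P<Q = begin-strict
          count P?                     <⟨ ℕₚ.m<m+n (count P?) (s≤s z≤n) ⟩
          count P? + 1                 ≡⟨ cong (count P? +_) (count-singleton x) ⟨
          count P? + count (x ≟_)      ≡⟨ count-∪-disjoint P? (x ≟_) (λ { y (p , refl) → ¬p p }) ⟨
          count (P? ∪? (x ≟_))         ≤⟨ count-mono (P? ∪? (x ≟_)) Q? (λ { (inj₁ p) → P⊆Q p ; (inj₂ refl) → q }) ⟩
          count Q?                     ∎

    Range : ∀ {k} → (Fin k → A) → Pred A 0ℓ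
    Range e x = ∃ λ i → e i ≡ x

    range? : ∀ {k} (e : Fin k → A) → Decidable (Range e)
    range? e x = Fin.any? (λ i → e i ≟ x)

    count-range : ∀ {k} (e : Fin k → A) → Injective _≡_ _≡_ e → count (range? e) ≡ k
    count-range {zero}  e inj = count-empty (range? e) (λ { x (() , _) })
    count-range {suc k} e inj = begin
      count (range? e)                                ≡⟨ count-cong (range? e) ((e zero ≟_) ∪? range? (e ∘ suc)) split ⟩
      count ((e zero ≟_) ∪? range? (e ∘ suc))         ≡⟨ count-∪-disjoint (e zero ≟_) (range? (e ∘ suc)) disjoint ⟩
      count (e zero ≟_) + count (range? (e ∘ suc))
        ≡⟨ cong₂ _+_ (count-singleton (e zero)) (count-range (e ∘ suc) (Fin.suc-injective ∘ inj)) ⟩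
      suc k                                           ∎
      where
      open ≡-Reasoning
      split : Range e ≐ (｛ e zero ｝ ∪ Range (e ∘ suc))
      split = (λ { (zero , refl) → inj₁ refl ; (suc i , refl) → inj₂ (i , refl) })
            , (λ { (inj₁ refl) → zero , refl ; (inj₂ (i , refl)) → suc i , refl })
      disjoint : Empty (｛ e zero ｝ ∩ Range (e ∘ suc))
      disjoint x (refl , i , e[1+i]≡e[0]) with inj e[1+i]≡e[0]
      ... | ()

    module Fibres (h : A → A) {D : Pred A 0ℓ} (D? : Decidable D) where

      Fibre : A → Pred A 0ℓ
      Fibre z x = D x × h x ≡ z

      fibre? : ∀ z → Decidable (Fibre z)
      fibre? z = D? ∩? (λ x → h x ≟ z)

      Image : Pred A 0ℓ
      Image z = ∃ (Fibre z)

      image? : Decidable Image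
      image? z = ∃? (fibre? z)

      count-fibres : ∀ {P : Pred A 0ℓ} (P? : Decidable P) →
                     count (D? ∩? (P? ∘ h)) ≡ ∑ (λ z → count (fibre? z) * indicator (P? z))
      count-fibres P? = begin
        ∑ (λ x → indicator (D? x ×-dec P? (h x)))
          ≡⟨ ∑-cong (λ x → trans (indicator-× (D? x) (P? (h x))) (cong (indicator (D? x) *_) (sym (count-singleton-∩ P? (h x))))) ⟩
        ∑ (λ x → indicator (D? x) * ∑ (λ z → indicator (h x ≟ z ×-dec P? z)))
          ≡⟨ ∑-cong (λ x → *-distribˡ-sum {m} (indicator (D? x)) (λ j → indicator (h x ≟ from j ×-dec P? (from j)))) ⟩
        ∑ (λ x → ∑ (λ z → indicator (D? x) * indicator (h x ≟ z ×-dec P? z)))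
          ≡⟨ ∑-cong (λ x → ∑-cong (λ z → regroup (D? x) (h x ≟ z) (P? z))) ⟩
        ∑ (λ x → ∑ (λ z → indicator (fibre? z x) * indicator (P? z)))
          ≡⟨ ∑-comm (λ i j → indicator (fibre? (from j) (from i)) * indicator (P? (from j))) ⟩
        ∑ (λ z → ∑ (λ x → indicator (fibre? z x) * indicator (P? z)))
          ≡⟨ ∑-cong (λ z → sym (*-distribʳ-sum {m} (indicator (P? z)) (λ i → indicator (fibre? z (from i))))) ⟩
        ∑ (λ z → count (fibre? z) * indicator (P? z)) ∎
        where
        open ≡-Reasoning
        regroup : {X Y Z : Set} (X? : Dec X) (Y? : Dec Y) (Z? : Dec Z) →
                  indicator X? * indicator (Y? ×-dec Z?) ≡ indicator (X? ×-dec Y?) * indicator Z?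
        regroup X? Y? Z? = begin
          indicator X? * indicator (Y? ×-dec Z?)       ≡⟨ cong (indicator X? *_) (indicator-× Y? Z?) ⟩
          indicator X? * (indicator Y? * indicator Z?) ≡⟨ ℕₚ.*-assoc (indicator X?) _ _ ⟨
          indicator X? * indicator Y? * indicator Z?   ≡⟨ cong (_* indicator Z?) (indicator-× X? Y?) ⟨
          indicator (X? ×-dec Y?) * indicator Z?       ∎

      count-uniform-fibres : ∀ k → (∀ z → Image z → count (fibre? z) ≡ k) →
                             ∀ {P : Pred A 0ℓ} (P? : Decidable P) →
                             count (D? ∩? (P? ∘ h)) ≡ k * count (P? ∩? image?)
      count-uniform-fibres k uniform P? = begin
        count (D? ∩? (P? ∘ h))                          ≡⟨ count-fibres P? ⟩
        ∑ (λ z → count (fibre? z) * indicator (P? z))   ≡⟨ ∑-cong term ⟩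
        ∑ (λ z → k * indicator (P? z ×-dec image? z))
          ≡⟨ *-distribˡ-sum {m} k (λ j → indicator (P? (from j) ×-dec image? (from j))) ⟨
        k * count (P? ∩? image?)                        ∎
        where
        open ≡-Reasoning
        term : ∀ z → count (fibre? z) * indicator (P? z) ≡ k * indicator (P? z ×-dec image? z)
        term z with image? z
        ... | yes z∈im = begin
          count (fibre? z) * indicator (P? z)     ≡⟨ cong (_* indicator (P? z)) (uniform z z∈im) ⟩
          k * indicator (P? z)                    ≡⟨ cong (k *_) (ℕₚ.*-identityʳ _) ⟨
          k * (indicator (P? z) * 1)              ≡⟨ cong (k *_) (indicator-× (P? z) (yes z∈im)) ⟨
          k * indicator (P? z ×-dec yes z∈im)     ∎
        ... | no z∉im = begin
          count (fibre? z) * indicator (P? z)     ≡⟨ cong (_* indicator (P? z)) (count-empty (fibre? z) (λ x fx → z∉im (x , fx))) ⟩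
          0                                       ≡⟨ ℕₚ.*-zeroʳ k ⟨
          k * 0                                   ≡⟨ cong (k *_) (ℕₚ.*-zeroʳ (indicator (P? z))) ⟨
          k * (indicator (P? z) * 0)              ≡⟨ cong (k *_) (indicator-× (P? z) (no z∉im)) ⟨
          k * indicator (P? z ×-dec no z∉im)      ∎

-- The ring solver for R, with coefficients in ℤ mapped into R.
module IntegerCoefficients {c ℓ : Level} (R : CommutativeRing c ℓ) where

  open import Data.Nat.Base using (zero; suc)
  import Data.Nat.Properties as ℕₚ
  open import Data.Integer.Base as ℤ using (ℤ; +_; -[1+_]; _⊖_; _◃_; ∣_∣; sign)
  import Data.Integer.Properties as ℤₚ
  open import Data.Sign.Base as Sign using (Sign)
  open import Data.Maybe.Base using (Maybe; just; nothing)
  open import Relation.Nullary using (yes; no)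
  import Relation.Binary.PropositionalEquality as ≡
  open import Algebra.Solver.Ring.AlmostCommutativeRing
    using (fromCommutativeRing; _-Raw-AlmostCommutative⟶_)

  open CommutativeRing R
  open import Algebra.Properties.Ring ring using (-0#≈0#; -‿involutive; -‿distribˡ-*; -‿distribʳ-*; -‿+-comm)
  open import Algebra.Properties.Semiring.Mult semiring using (_×_; ×-homo-+; ×1-homo-*)
  open import Relation.Binary.Reasoning.Setoid setoid

  signed : Sign → Carrier → Carrier
  signed Sign.+ x = x
  signed Sign.- x = - x

  signed-cong : ∀ s {x y} → x ≈ y → signed s x ≈ signed s y
  signed-cong Sign.+ x≈y = x≈y
  signed-cong Sign.- x≈y = -‿cong x≈y

  fromℤ : ℤ → Carrier
  fromℤ i = signed (sign i) (∣ i ∣ × 1#)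

  fromℤ-◃ : ∀ s n → fromℤ (s ◃ n) ≈ signed s (n × 1#)
  fromℤ-◃ Sign.+ zero    = refl
  fromℤ-◃ Sign.- zero    = sym -0#≈0#
  fromℤ-◃ Sign.+ (suc n) = refl
  fromℤ-◃ Sign.- (suc n) = refl

  signed-* : ∀ s t x y → signed (s Sign.* t) (x * y) ≈ signed s x * signed t y
  signed-* Sign.+ Sign.+ x y = refl
  signed-* Sign.+ Sign.- x y = -‿distribʳ-* x y
  signed-* Sign.- Sign.+ x y = -‿distribˡ-* x y
  signed-* Sign.- Sign.- x y = begin
    x * y         ≈⟨ *-congʳ (-‿involutive x) ⟨
    - (- x) * y   ≈⟨ -‿distribˡ-* (- x) y ⟨
    - (- x * y)   ≈⟨ -‿distribʳ-* (- x) y ⟩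
    - x * - y     ∎

  fromℤ-* : ∀ i j → fromℤ (i ℤ.* j) ≈ fromℤ i * fromℤ j
  fromℤ-* i j = begin
    fromℤ (sign i Sign.* sign j ◃ ∣ i ∣ ℕ.* ∣ j ∣)               ≈⟨ fromℤ-◃ (sign i Sign.* sign j) (∣ i ∣ ℕ.* ∣ j ∣) ⟩
    signed (sign i Sign.* sign j) ((∣ i ∣ ℕ.* ∣ j ∣) × 1#)         ≈⟨ signed-cong (sign i Sign.* sign j) (×1-homo-* ∣ i ∣ ∣ j ∣) ⟩
    signed (sign i Sign.* sign j) ((∣ i ∣ × 1#) * (∣ j ∣ × 1#))    ≈⟨ signed-* (sign i) (sign j) _ _ ⟩
    fromℤ i * fromℤ j                                              ∎

  fromℤ-neg : ∀ i → fromℤ (ℤ.- i) ≈ - fromℤ i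
  fromℤ-neg -[1+ n ]    = sym (-‿involutive _)
  fromℤ-neg (+ zero)    = sym -0#≈0#
  fromℤ-neg (+ (suc n)) = refl

  1+x-[1+y]≈x-y : ∀ x y → (1# + x) - (1# + y) ≈ x - y
  1+x-[1+y]≈x-y x y = begin
    (1# + x) + - (1# + y)       ≈⟨ +-congˡ (-‿+-comm 1# y) ⟨
    (1# + x) + (- 1# + - y)     ≈⟨ +-congʳ (+-comm 1# x) ⟩
    (x + 1#) + (- 1# + - y)     ≈⟨ +-assoc x 1# _ ⟩
    x + (1# + (- 1# + - y))     ≈⟨ +-congˡ (+-assoc 1# (- 1#) (- y)) ⟨
    x + ((1# - 1#) + - y)       ≈⟨ +-congˡ (+-congʳ (-‿inverseʳ 1#)) ⟩
    x + (0# + - y)              ≈⟨ +-congˡ (+-identityˡ (- y)) ⟩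
    x - y                       ∎

  fromℤ-⊖ : ∀ a b → fromℤ (a ⊖ b) ≈ (a × 1#) - (b × 1#)
  fromℤ-⊖ zero    zero    = sym (trans (+-identityˡ _) -0#≈0#)
  fromℤ-⊖ (suc a) zero    = sym (trans (+-congˡ -0#≈0#) (+-identityʳ _))
  fromℤ-⊖ zero    (suc b) = sym (+-identityˡ _)
  fromℤ-⊖ (suc a) (suc b) = begin
    fromℤ (suc a ⊖ suc b)              ≡⟨ ≡.cong fromℤ (ℤₚ.[1+m]⊖[1+n]≡m⊖n a b) ⟩
    fromℤ (a ⊖ b)                      ≈⟨ fromℤ-⊖ a b ⟩
    (a × 1#) - (b × 1#)                ≈⟨ 1+x-[1+y]≈x-y _ _ ⟨
    (suc a × 1#) - (suc b × 1#)        ∎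

  fromℤ-+ : ∀ i j → fromℤ (i ℤ.+ j) ≈ fromℤ i + fromℤ j
  fromℤ-+ -[1+ a ] -[1+ b ] = begin
    - (suc (suc (a ℕ.+ b)) × 1#)         ≡⟨ ≡.cong (λ k → - (suc k × 1#)) (ℕₚ.+-suc a b) ⟨
    - ((suc a ℕ.+ suc b) × 1#)           ≈⟨ -‿cong (×-homo-+ 1# (suc a) (suc b)) ⟩
    - ((suc a × 1#) + (suc b × 1#))      ≈⟨ -‿+-comm _ _ ⟨
    fromℤ -[1+ a ] + fromℤ -[1+ b ]      ∎
  fromℤ-+ -[1+ a ] (+ b)    = trans (fromℤ-⊖ b (suc a)) (+-comm _ _)
  fromℤ-+ (+ a)    -[1+ b ] = fromℤ-⊖ a (suc b)
  fromℤ-+ (+ a)    (+ b)    = ×-homo-+ 1# a b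

  fromℤ-homomorphism : ℤ.+-*-rawRing -Raw-AlmostCommutative⟶ fromCommutativeRing R
  fromℤ-homomorphism = record
    { ⟦_⟧    = fromℤ
    ; +-homo = fromℤ-+
    ; *-homo = fromℤ-*
    ; -‿homo = fromℤ-neg
    ; 0-homo = refl
    ; 1-homo = +-identityʳ 1#
    }

  fromℤ-≟ : ∀ i j → Maybe (fromℤ i ≈ fromℤ j)
  fromℤ-≟ i j with i ℤₚ.≟ j
  ... | yes ≡.refl = just refl
  ... | no _       = nothing

  open import Algebra.Solver.Ring ℤ.+-*-rawRing (fromCommutativeRing R) fromℤ-homomorphism fromℤ-≟
    public using (solve; _:=_; _:+_; _:*_; _:-_; :-_; con)

module PrimeBinomial where

  open import Data.Nat.Base using (zero; suc; _*_; _∸_; _≤_; _<_; _!)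
  import Data.Nat.Properties as ℕₚ
  open import Data.Nat.Divisibility using (_∣_; _∤_; ∣⇒≤; ∣1⇒≡1; m∣m*n)
  open import Data.Nat.DivMod using (m/n*n≡m)
  open import Data.Nat.Primality using (Prime; euclidsLemma; ¬prime[0]; ¬prime[1])
  open import Data.Nat.Combinatorics using (_C_; nCk≡n!/k![n-k]!; k![n∸k]!∣n!)
  open import Data.Sum.Base using (inj₁; inj₂)
  open import Data.Empty using (⊥-elim)
  open import Relation.Binary.PropositionalEquality using (_≡_; sym; subst; trans; cong)

  prime∤! : ∀ {p} → Prime p → ∀ {j} → j < p → p ∤ j !
  prime∤! p-prime {zero}  j<p p∣1 = ¬prime[1] (subst Prime (∣1⇒≡1 p∣1) p-prime)
  prime∤! p-prime {suc j} j<p p∣j! with euclidsLemma (suc j) (j !) p-prime p∣j!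
  ... | inj₁ p∣1+j = ℕₚ.<⇒≱ j<p (∣⇒≤ p∣1+j)
  ... | inj₂ p∣j!  = prime∤! p-prime (ℕₚ.<-trans (ℕₚ.n<1+n j) j<p) p∣j!

  C*k![n-k]!≡n! : ∀ {n k} → k ≤ n → (n C k) * (k ! * (n ∸ k) !) ≡ n !
  C*k![n-k]!≡n! {n} {k} k≤n = trans (cong (_* (k ! * (n ∸ k) !)) (nCk≡n!/k![n-k]! k≤n))
                                    (m/n*n≡m (k![n∸k]!∣n! k≤n))
    where
    instance
      k![n-k]!≢0 : ℕ.NonZero (k ! * (n ∸ k) !)
      k![n-k]!≢0 = ℕₚ._!*_!≢0 k (n ∸ k)

  prime∣C : ∀ {p} → Prime p → ∀ {k} → 0 < k → k < p → p ∣ p C k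
  prime∣C {zero}  p-prime = ⊥-elim (¬prime[0] p-prime)
  prime∣C {suc q} p-prime {k} 0<k k<p with euclidsLemma (suc q C k) (k ! * (suc q ∸ k) !) p-prime
                                           (subst (suc q ∣_) (sym (C*k![n-k]!≡n! (ℕₚ.<⇒≤ k<p))) (m∣m*n (q !)))
  ... | inj₁ p∣C = p∣C
  ... | inj₂ p∣k![p-k]! with euclidsLemma (k !) ((suc q ∸ k) !) p-prime p∣k![p-k]!
  ...   | inj₁ p∣k!     = ⊥-elim (prime∤! p-prime k<p p∣k!)
  ...   | inj₂ p∣[p-k]! = ⊥-elim (prime∤! p-prime (ℕₚ.∸-monoʳ-< 0<k (ℕₚ.<⇒≤ k<p)) p∣[p-k]!)

module Field {m : ℕ} (F : FiniteField m) where

  open import Level using (0ℓ)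
  open import Data.Nat.Base using (zero; suc)
  import Data.Nat.Properties as ℕₚ
  open import Data.Product.Base using (_,_; proj₁; proj₂)
  open import Data.Sum.Base using (_⊎_; inj₁; inj₂)
  open import Data.Empty using (⊥-elim)
  open import Function.Base using (id; _∘_)
  open import Function.Bundles using (_↔_; Inverse; mk↔ₛ′)
  open import Relation.Nullary using (yes; no; ¬?)
  open import Relation.Unary using (Pred; Decidable; Universal; _∪_; ｛_｝)
  open import Relation.Unary.Properties using (U?; _∪?_)
  open import Relation.Binary.PropositionalEquality
    using (_≡_; _≢_; refl; sym; trans; cong; cong₂; module ≡-Reasoning)
  open import Algebra.Bundles using (CommutativeRing)
  open ≡-Reasoning

  open FiniteField F public using (Carrier; 0≢1; inverse; card; pow)

  commutativeRing : CommutativeRing 0ℓ 0ℓ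
  commutativeRing = record { isCommutativeRing = FiniteField.isCommutativeRing F }

  open CommutativeRing commutativeRing public
    using (_+_; _*_; -_; _-_; 0#; 1#; +-comm; +-identityˡ; +-identityʳ; -‿inverseˡ; -‿inverseʳ;
           *-assoc; *-comm; *-identityˡ; *-identityʳ; zeroˡ; zeroʳ;
           ring; semiring; commutativeSemiring; +-monoid; +-commutativeMonoid; *-commutativeMonoid)
  open import Algebra.Properties.Ring ring public
    using (-‿involutive; -1*x≈-x; +-cancelˡ; +-cancelʳ; +-inverseʳ-unique; x∙y⁻¹≈ε⇒x≈y)
  open import Algebra.Properties.Semiring.Mult semiring public using (_×_; ×-homo-+; ×1-homo-*; ×-assoc-*)
  open import Algebra.Properties.Semiring.Exp semiring public using (_^_; ^-assocʳ)
  open import Algebra.Properties.CommutativeSemiring.Exp commutativeSemiring public using (^-distrib-*)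
  open IntegerCoefficients commutativeRing public
  open Counting using (indicator)
  open Counting.Enumerated card public

  open Inverse card public using (to; from) renaming (strictlyInverseˡ to to∘from; strictlyInverseʳ to from∘to)

  pow≗^ : ∀ x n → pow x n ≡ x ^ n
  pow≗^ x zero    = refl
  pow≗^ x (suc n) = cong (x *_) (pow≗^ x n)

  ×-as-* : ∀ k x → k × x ≡ (k × 1#) * x
  ×-as-* k x = trans (cong (k ×_) (sym (*-identityˡ x))) (sym (×-assoc-* k 1# x))

  1≢0 : 1# ≢ 0#
  1≢0 = 0≢1 ∘ sym

  ×1≡0⇒multiple×x≡0 : ∀ {a} → a × 1# ≡ 0# → ∀ c x → (c ℕ.* a) × x ≡ 0#
  ×1≡0⇒multiple×x≡0 {a} a×1≡0 c x = begin
    (c ℕ.* a) × x                  ≡⟨ ×-as-* (c ℕ.* a) x ⟩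
    (c ℕ.* a) × 1# * x             ≡⟨ cong (_* x) (×1-homo-* c a) ⟩
    (c × 1#) * (a × 1#) * x        ≡⟨ cong (λ z → (c × 1#) * z * x) a×1≡0 ⟩
    (c × 1#) * 0# * x              ≡⟨ cong (_* x) (zeroʳ (c × 1#)) ⟩
    0# * x                         ≡⟨ zeroˡ x ⟩
    0#                             ∎

  zero-product : ∀ {x y} → x * y ≡ 0# → x ≡ 0# ⊎ y ≡ 0#
  zero-product {x} {y} xy≡0 with x ≟ 0#
  ... | yes x≡0 = inj₁ x≡0
  ... | no  x≢0 = inj₂ (begin
    y                ≡⟨ *-identityˡ y ⟨
    1# * y           ≡⟨ cong (_* y) xx⁻¹≡1 ⟨
    x * x⁻¹ * y      ≡⟨ solve 3 (λ x x⁻¹ y → x :* x⁻¹ :* y := x⁻¹ :* (x :* y)) refl x x⁻¹ y ⟩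
    x⁻¹ * (x * y)    ≡⟨ cong (x⁻¹ *_) xy≡0 ⟩
    x⁻¹ * 0#         ≡⟨ zeroʳ x⁻¹ ⟩
    0#               ∎)
    where
    x⁻¹ : Carrier
    x⁻¹ = proj₁ (inverse x x≢0)
    xx⁻¹≡1 : x * x⁻¹ ≡ 1#
    xx⁻¹≡1 = proj₂ (inverse x x≢0)

  *-≢0 : ∀ {x y} → x ≢ 0# → y ≢ 0# → x * y ≢ 0#
  *-≢0 x≢0 y≢0 xy≡0 with zero-product xy≡0
  ... | inj₁ x≡0 = x≢0 x≡0
  ... | inj₂ y≡0 = y≢0 y≡0

  *-cancelʳ : ∀ {x y z} → z ≢ 0# → x * z ≡ y * z → x ≡ y
  *-cancelʳ {x} {y} {z} z≢0 xz≡yz with zero-product (begin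
    (x - y) * z      ≡⟨ solve 3 (λ x y z → (x :- y) :* z := x :* z :- y :* z) refl x y z ⟩
    x * z - y * z    ≡⟨ cong (_- y * z) xz≡yz ⟩
    y * z - y * z    ≡⟨ -‿inverseʳ (y * z) ⟩
    0#               ∎)
  ... | inj₁ x-y≡0 = x∙y⁻¹≈ε⇒x≈y x y x-y≡0
  ... | inj₂ z≡0   = ⊥-elim (z≢0 z≡0)

  ^-≢0 : ∀ {x} n → x ≢ 0# → x ^ n ≢ 0#
  ^-≢0 zero    x≢0 = 1≢0
  ^-≢0 (suc n) x≢0 = *-≢0 x≢0 (^-≢0 n x≢0)

  ^≡0⇒≡0 : ∀ {x} n → x ^ n ≡ 0# → x ≡ 0#
  ^≡0⇒≡0 {x} n xⁿ≡0 with x ≟ 0#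
  ... | yes x≡0 = x≡0
  ... | no  x≢0 = ⊥-elim (^-≢0 n x≢0 xⁿ≡0)

  1^n≡1 : ∀ n → 1# ^ n ≡ 1#
  1^n≡1 zero    = refl
  1^n≡1 (suc n) = trans (*-identityˡ _) (1^n≡1 n)

  ×1-homo-^ : ∀ a n → (a ℕ.^ n) × 1# ≡ (a × 1#) ^ n
  ×1-homo-^ a zero    = +-identityʳ 1#
  ×1-homo-^ a (suc n) = trans (×1-homo-* a (a ℕ.^ n)) (cong ((a × 1#) *_) (×1-homo-^ a n))

  +-↔ : Carrier → Carrier ↔ Carrier
  +-↔ a = mk↔ₛ′ (_+ a) (_- a)
    (λ y → solve 2 (λ y a → y :- a :+ a := y) refl y a)
    (λ y → solve 2 (λ y a → y :+ a :- a := y) refl y a)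

  *-↔ : ∀ {a} → a ≢ 0# → Carrier ↔ Carrier
  *-↔ {a} a≢0 = mk↔ₛ′ (_* a) (_* a⁻¹)
    (λ y → trans (*-assoc y a⁻¹ a) (trans (cong (y *_) (trans (*-comm a⁻¹ a) aa⁻¹≡1)) (*-identityʳ y)))
    (λ y → trans (*-assoc y a a⁻¹) (trans (cong (y *_) aa⁻¹≡1) (*-identityʳ y)))
    where
    a⁻¹ : Carrier
    a⁻¹ = proj₁ (inverse a a≢0)
    aa⁻¹≡1 : a * a⁻¹ ≡ 1#
    aa⁻¹≡1 = proj₂ (inverse a a≢0)

  size×x≡0 : ∀ x → m × x ≡ 0#
  size×x≡0 x = +-cancelˡ (∑ id) (m × x) 0# (begin
    ∑ id + m × x               ≡⟨ cong (∑ id +_) size×x≡∑x ⟩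
    ∑ id + ∑ (λ _ → x)         ≡⟨ ∑-distrib id (λ _ → x) ⟨
    ∑ (_+ x)                   ≡⟨ ∑-permute (+-↔ x) id ⟩
    ∑ id                       ≡⟨ +-identityʳ (∑ id) ⟨
    ∑ id + 0#                  ∎)
    where
    open Counting.FiniteSum card +-commutativeMonoid
    size×x≡∑x : m × x ≡ ∑ (λ _ → x)
    size×x≡∑x = begin
      m × x                  ≡⟨ cong (_× x) (count-universal U? (λ _ → _)) ⟨
      count U? × x           ≡⟨ ∑-× (λ _ → 1) x ⟨
      ∑ (λ _ → 1 × x)        ≡⟨ ∑-cong (λ _ → +-identityʳ x) ⟩
      ∑ (λ _ → x)            ∎

  size≡p^k⇒p×1≡0 : ∀ p k → m ≡ p ℕ.^ k → p × 1# ≡ 0#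
  size≡p^k⇒p×1≡0 p k m≡pᵏ = ^≡0⇒≡0 k (begin
    (p × 1#) ^ k      ≡⟨ ×1-homo-^ p k ⟨
    (p ℕ.^ k) × 1#    ≡⟨ cong (_× 1#) m≡pᵏ ⟨
    m × 1#            ≡⟨ size×x≡0 1# ⟩
    0#                ∎)

  NonZero : Pred Carrier 0ℓ
  NonZero x = x ≢ 0#

  nonZero? : Decidable NonZero
  nonZero? x = ¬? (x ≟ 0#)

  suc-count-nonZero : suc (count nonZero?) ≡ m
  suc-count-nonZero = begin
    suc (count nonZero?)                  ≡⟨ ℕₚ.+-comm 1 (count nonZero?) ⟩
    count nonZero? ℕ.+ 1                  ≡⟨ cong (count nonZero? ℕ.+_) (count-singleton 0#) ⟨
    count nonZero? ℕ.+ count (0# ≟_)      ≡⟨ count-∪-disjoint nonZero? (0# ≟_) (λ { x (x≢0 , 0≡x) → x≢0 (sym 0≡x) }) ⟨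
    count (nonZero? ∪? (0# ≟_))           ≡⟨ count-universal (nonZero? ∪? (0# ≟_)) nonZero∪zero ⟩
    m                                     ∎
    where
    nonZero∪zero : Universal (NonZero ∪ ｛ 0# ｝)
    nonZero∪zero x with x ≟ 0#
    ... | yes x≡0 = inj₂ (sym x≡0)
    ... | no  x≢0 = inj₁ x≢0

  -- y ↦ y * a permutes the nonzero elements; compare the products of orOne over y and over y * a.
  ^-count-nonZero : ∀ {a} → a ≢ 0# → a ^ count nonZero? ≡ 1#
  ^-count-nonZero {a} a≢0 = *-cancelʳ (∏-preserves NonZero 1≢0 *-≢0 orOne orOne-≢0) (begin
    a ^ count nonZero? * ∏ orOne                          ≡⟨ cong (_* ∏ orOne) (∏-^ (indicator ∘ nonZero?) a) ⟨
    ∏ (λ y → a ^ indicator (nonZero? y)) * ∏ orOne        ≡⟨ ∏-distrib (λ y → a ^ indicator (nonZero? y)) orOne ⟨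
    ∏ (λ y → a ^ indicator (nonZero? y) * orOne y)        ≡⟨ ∏-cong scale ⟩
    ∏ (orOne ∘ (_* a))                                    ≡⟨ ∏-permute (*-↔ a≢0) orOne ⟩
    ∏ orOne                                               ≡⟨ *-identityˡ (∏ orOne) ⟨
    1# * ∏ orOne                                          ∎)
    where
    open Counting.FiniteSum card *-commutativeMonoid
      renaming (∑ to ∏; ∑-cong to ∏-cong; ∑-distrib to ∏-distrib; ∑-permute to ∏-permute; ∑-× to ∏-^;
                ∑-preserves to ∏-preserves)
    orOne : Carrier → Carrier
    orOne y with y ≟ 0#
    ... | yes _ = 1#
    ... | no  _ = y
    orOne-≢0 : ∀ y → orOne y ≢ 0#
    orOne-≢0 y with y ≟ 0#
    ... | yes _   = 1≢0
    ... | no  y≢0 = y≢0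
    scale : ∀ y → a ^ indicator (nonZero? y) * orOne y ≡ orOne (y * a)
    scale y with y ≟ 0# | y * a ≟ 0#
    ... | yes _   | yes _    = *-identityˡ 1#
    ... | yes y≡0 | no ya≢0  = ⊥-elim (ya≢0 (trans (cong (_* a) y≡0) (zeroˡ a)))
    ... | no  y≢0 | yes ya≡0 = ⊥-elim (*-≢0 y≢0 a≢0 ya≡0)
    ... | no  _   | no  _    = trans (cong (_* y) (*-identityʳ a)) (*-comm a y)

  ^-size : ∀ x → x ^ m ≡ x
  ^-size x with x ≟ 0#
  ... | yes refl = trans (cong (0# ^_) (sym suc-count-nonZero)) (zeroˡ _)
  ... | no  x≢0  = begin
    x ^ m                        ≡⟨ cong (x ^_) suc-count-nonZero ⟨
    x * x ^ count nonZero?       ≡⟨ cong (x *_) (^-count-nonZero x≢0) ⟩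
    x * 1#                       ≡⟨ *-identityʳ x ⟩
    x                            ∎

  module Characteristic (s : ℕ) (prime : Prime (suc s)) (char : suc s × 1# ≡ 0#) where

    open import Data.Nat.Base using (_<_; _∸_; z≤n; s≤s)
    open import Data.Nat.Divisibility using (divides)
    open import Data.Nat.Coprimality using (prime⇒coprime; coprime-Bézout)
    open import Data.Nat.GCD using (module Bézout)
    open import Data.Nat.Combinatorics using (_C_; nCn≡1)
    open import Data.Fin.Base using (Fin; zero; suc; toℕ; inject₁; fromℕ)
    import Data.Fin.Properties as Fin
    open import Relation.Binary.PropositionalEquality using (subst)
    open import Relation.Binary.Definitions using (tri<; tri≈; tri>)
    open PrimeBinomial using (prime∣C)
    import Algebra.Properties.CommutativeSemiring.Binomial commutativeSemiring as Binomial
    import Algebra.Properties.Monoid.Sum +-monoid as Sum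

    p : ℕ
    p = suc s

    1+u≢v : ∀ {u v} → u × 1# ≡ 0# → v × 1# ≡ 0# → suc u ≢ v
    1+u≢v {u} {v} u×1≡0 v×1≡0 1+u≡v = 1≢0 (begin
      1#                  ≡⟨ +-identityʳ 1# ⟨
      1# + 0#             ≡⟨ cong (1# +_) u×1≡0 ⟨
      suc u × 1#          ≡⟨ cong (_× 1#) 1+u≡v ⟩
      v × 1#              ≡⟨ v×1≡0 ⟩
      0#                  ∎)

    frobenius-+ : ∀ x y → (x + y) ^ p ≡ x ^ p + y ^ p
    frobenius-+ x y = begin
      (x + y) ^ p                                         ≡⟨ Binomial.theorem p x y ⟩
      term zero + Sum.sum (term ∘ suc)                    ≡⟨ cong (term zero +_) (Sum.sum-init-last (term ∘ suc)) ⟩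
      term zero + (Sum.sum (term ∘ suc ∘ inject₁) + term (suc (fromℕ s)))
        ≡⟨ cong₂ (λ u v → term zero + (u + v)) (trans (Sum.sum-cong-≗ middle) (Sum.sum-replicate-zero s)) last ⟩
      term zero + (0# + x ^ p)                            ≡⟨ cong₂ _+_ first (+-identityˡ (x ^ p)) ⟩
      y ^ p + x ^ p                                       ≡⟨ +-comm (y ^ p) (x ^ p) ⟩
      x ^ p + y ^ p                                       ∎
      where
      term : Fin (suc p) → Carrier
      term = Binomial.binomialTerm x y p
      middle : ∀ i → term (suc (inject₁ i)) ≡ 0#
      middle i with prime∣C prime {suc (toℕ (inject₁ i))} (s≤s z≤n) (s≤s (subst (_< s) (sym (Fin.toℕ-inject₁ i)) (Fin.toℕ<n i)))
      ... | divides c p∣C = trans (cong (_× Binomial.binomial x y p (suc (inject₁ i))) p∣C) (×1≡0⇒multiple×x≡0 char c _)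
      last : term (suc (fromℕ s)) ≡ x ^ p
      last = begin
        (p C suc (toℕ (fromℕ s))) × (x ^ suc (toℕ (fromℕ s)) * y ^ (p ∸ suc (toℕ (fromℕ s))))
          ≡⟨ cong (λ k → (p C suc k) × (x ^ suc k * y ^ (s ∸ k))) (Fin.toℕ-fromℕ s) ⟩
        (p C p) × (x ^ p * y ^ (s ∸ s))  ≡⟨ cong₂ (λ c k → c × (x ^ p * y ^ k)) (nCn≡1 p) (ℕₚ.n∸n≡0 s) ⟩
        1 × (x ^ p * 1#)                 ≡⟨ +-identityʳ _ ⟩
        x ^ p * 1#                       ≡⟨ *-identityʳ _ ⟩
        x ^ p                            ∎
      first : term zero ≡ y ^ p
      first = trans (+-identityʳ _) (*-identityˡ _)

    frobenius-neg : ∀ x → (- x) ^ p ≡ - x ^ p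
    frobenius-neg x = +-inverseʳ-unique (x ^ p) ((- x) ^ p) (begin
      x ^ p + (- x) ^ p     ≡⟨ frobenius-+ x (- x) ⟨
      (x + - x) ^ p         ≡⟨ cong (_^ p) (-‿inverseʳ x) ⟩
      0# ^ p                ≡⟨ zeroˡ _ ⟩
      0#                    ∎)

    frobeniusᵏ-+ : ∀ k x y → (x + y) ^ (p ℕ.^ k) ≡ x ^ (p ℕ.^ k) + y ^ (p ℕ.^ k)
    frobeniusᵏ-+ zero    x y = trans (*-identityʳ _) (sym (cong₂ _+_ (*-identityʳ x) (*-identityʳ y)))
    frobeniusᵏ-+ (suc k) x y = begin
      (x + y) ^ (p ℕ.* p ℕ.^ k)                 ≡⟨ ^-assocʳ (x + y) p (p ℕ.^ k) ⟨
      ((x + y) ^ p) ^ (p ℕ.^ k)                 ≡⟨ cong (_^ (p ℕ.^ k)) (frobenius-+ x y) ⟩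
      (x ^ p + y ^ p) ^ (p ℕ.^ k)               ≡⟨ frobeniusᵏ-+ k (x ^ p) (y ^ p) ⟩
      (x ^ p) ^ (p ℕ.^ k) + (y ^ p) ^ (p ℕ.^ k) ≡⟨ cong₂ _+_ (^-assocʳ x p (p ℕ.^ k)) (^-assocʳ y p (p ℕ.^ k)) ⟩
      x ^ (p ℕ.* p ℕ.^ k) + y ^ (p ℕ.* p ℕ.^ k) ∎

    frobeniusᵏ-neg : ∀ k x → (- x) ^ (p ℕ.^ k) ≡ - x ^ (p ℕ.^ k)
    frobeniusᵏ-neg k x = +-inverseʳ-unique (x ^ (p ℕ.^ k)) ((- x) ^ (p ℕ.^ k)) (begin
      x ^ (p ℕ.^ k) + (- x) ^ (p ℕ.^ k)     ≡⟨ frobeniusᵏ-+ k x (- x) ⟨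
      (x + - x) ^ (p ℕ.^ k)                 ≡⟨ cong (_^ (p ℕ.^ k)) (-‿inverseʳ x) ⟩
      0# ^ (p ℕ.^ k)                        ≡⟨ cong (0# ^_) (ℕₚ.suc-pred (p ℕ.^ k) {{ℕₚ.m^n≢0 p k}}) ⟨
      0# ^ suc (ℕ.pred (p ℕ.^ k))           ≡⟨ zeroˡ _ ⟩
      0#                                    ∎)

    ×1-^p : ∀ j → (j × 1#) ^ p ≡ j × 1#
    ×1-^p zero    = zeroˡ _
    ×1-^p (suc j) = begin
      (1# + j × 1#) ^ p           ≡⟨ frobenius-+ 1# (j × 1#) ⟩
      1# ^ p + (j × 1#) ^ p       ≡⟨ cong₂ _+_ (1^n≡1 p) (×1-^p j) ⟩
      1# + j × 1#                 ∎

    ×1-≢0 : ∀ {j} → 0 < j → j < p → j × 1# ≢ 0#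
    ×1-≢0 {j} 0<j j<p j×1≡0 with coprime-Bézout (prime⇒coprime prime {{ℕ.>-nonZero 0<j}} j<p)
    ... | Bézout.+- a b 1+bj≡ap = 1+u≢v (×1≡0⇒multiple×x≡0 j×1≡0 b 1#) (×1≡0⇒multiple×x≡0 char a 1#) 1+bj≡ap
    ... | Bézout.-+ a b 1+ap≡bj = 1+u≢v (×1≡0⇒multiple×x≡0 char a 1#) (×1≡0⇒multiple×x≡0 j×1≡0 b 1#) 1+ap≡bj

    ×1-≡⇒∸×1≡0 : ∀ {a b} → a < b → a × 1# ≡ b × 1# → (b ∸ a) × 1# ≡ 0#
    ×1-≡⇒∸×1≡0 {a} {b} a<b a≡b = +-cancelʳ (a × 1#) ((b ∸ a) × 1#) 0# (begin
      (b ∸ a) × 1# + a × 1#     ≡⟨ ×-homo-+ 1# (b ∸ a) a ⟨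
      (b ∸ a ℕ.+ a) × 1#        ≡⟨ cong (_× 1#) (ℕₚ.m∸n+n≡m (ℕₚ.<⇒≤ a<b)) ⟩
      b × 1#                    ≡⟨ a≡b ⟨
      a × 1#                    ≡⟨ +-identityˡ _ ⟨
      0# + a × 1#               ∎)

    ×1-injective : ∀ {i j} → i < p → j < p → i × 1# ≡ j × 1# → i ≡ j
    ×1-injective {i} {j} i<p j<p i≡j with ℕₚ.<-cmp i j
    ... | tri< i<j _ _ = ⊥-elim (×1-≢0 (ℕₚ.m<n⇒0<n∸m i<j) (ℕₚ.≤-<-trans (ℕₚ.m∸n≤m j i) j<p) (×1-≡⇒∸×1≡0 i<j i≡j))
    ... | tri≈ _ i≡j _ = i≡j
    ... | tri> _ _ j<i = ⊥-elim (×1-≢0 (ℕₚ.m<n⇒0<n∸m j<i) (ℕₚ.≤-<-trans (ℕₚ.m∸n≤m i j) i<p) (×1-≡⇒∸×1≡0 j<i (sym i≡j)))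

module MonicPolynomial {m : ℕ} (F : FiniteField m) where

  open import Data.Nat.Base using (zero; suc; _≤_; _<_; z≤n; s≤s)
  import Data.Nat.Properties as ℕₚ
  open import Data.Product.Base using (Σ; _,_)
  open import Data.Sum.Base using (_⊎_; inj₁; inj₂)
  open import Data.Unit.Base using (⊤; tt)
  open import Relation.Nullary using (yes; no)
  open import Relation.Unary using (Decidable; _∪_; ｛_｝)
  open import Relation.Unary.Properties using (_∪?_)
  open import Relation.Binary.PropositionalEquality
    using (_≡_; refl; sym; trans; cong; cong₂; module ≡-Reasoning)
  open Field F

  -- (c₀ , c₁ , … , c_{d-1} , tt) stands for x ^ d + c_{d-1} x ^ (d-1) + … + c₀, evaluated by Horner's rule.
  Monic : ℕ → Set
  Monic zero    = ⊤
  Monic (suc d) = Σ Carrier λ _ → Monic d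

  eval : ∀ {d} → Monic d → Carrier → Carrier
  eval {zero}  _       x = 1#
  eval {suc d} (c , P) x = c + x * eval P x

  root? : ∀ {d} (P : Monic d) → Decidable (λ x → eval P x ≡ 0#)
  root? P x = eval P x ≟ 0#

  linear-division : ∀ {d} (P : Monic (suc d)) a →
                   Σ (Monic d) λ Q → ∀ x → eval P x ≡ eval P a + (x - a) * eval Q x
  linear-division {zero} (c , tt) a = tt , λ x → solve 4 (λ c x a o → c :+ x :* o := c :+ a :* o :+ (x :- a) :* o) refl c x a 1#
  linear-division {suc d} (c , P) a with linear-division P a
  ... | Q , P≡ = (eval P a , Q) , λ x → begin
    c + x * eval P x                                        ≡⟨ cong (λ z → c + x * z) (P≡ x) ⟩
    c + x * (eval P a + (x - a) * eval Q x)                 ≡⟨ solve 5 (λ c x a u v → c :+ x :* (u :+ (x :- a) :* v)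
                                                                           := c :+ a :* u :+ (x :- a) :* (u :+ x :* v))
                                                                      refl c x a (eval P a) (eval Q x) ⟩
    (c + a * eval P a) + (x - a) * (eval P a + x * eval Q x) ∎
    where open ≡-Reasoning

  factor-theorem : ∀ {d} (P : Monic (suc d)) {a} → eval P a ≡ 0# →
                   Σ (Monic d) λ Q → ∀ x → eval P x ≡ (x - a) * eval Q x
  factor-theorem P {a} Pa≡0 with linear-division P a
  ... | Q , P≡ = Q , λ x → trans (P≡ x) (trans (cong (_+ (x - a) * eval Q x) Pa≡0) (+-identityˡ _))

  count-roots : ∀ {d} (P : Monic d) → count (root? P) ≤ d
  count-roots {zero}  P = ℕₚ.≤-reflexive (count-empty (root? P) (λ _ → 1≢0))
  count-roots {suc d} P with ∃? (root? P)
  ... | no  no-root = ℕₚ.≤-trans (ℕₚ.≤-reflexive (count-empty (root? P) (λ x Px≡0 → no-root (x , Px≡0)))) z≤n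
  ... | yes (a , Pa≡0) with factor-theorem P Pa≡0
  ...   | Q , P≡ = begin
    count (root? P)                          ≤⟨ count-mono (root? P) ((a ≟_) ∪? root? Q) split ⟩
    count ((a ≟_) ∪? root? Q)                ≤⟨ count-∪ (a ≟_) (root? Q) ⟩
    count (a ≟_) ℕ.+ count (root? Q)         ≡⟨ cong (ℕ._+ count (root? Q)) (count-singleton a) ⟩
    suc (count (root? Q))                    ≤⟨ s≤s (count-roots Q) ⟩
    suc d                                    ∎
    where
    open ℕₚ.≤-Reasoning
    split : ∀ {x} → eval P x ≡ 0# → a ≡ x ⊎ eval Q x ≡ 0#
    split {x} Px≡0 with zero-product (trans (sym (P≡ x)) Px≡0)
    ... | inj₁ x-a≡0 = inj₁ (sym (x∙y⁻¹≈ε⇒x≈y x a x-a≡0))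
    ... | inj₂ Qx≡0  = inj₂ Qx≡0

  xᵈ : ∀ d → Monic d
  xᵈ zero    = tt
  xᵈ (suc d) = 0# , xᵈ d

  eval-xᵈ : ∀ d x → eval (xᵈ d) x ≡ x ^ d
  eval-xᵈ zero    x = refl
  eval-xᵈ (suc d) x = trans (+-identityˡ _) (cong (x *_) (eval-xᵈ d x))

  xᵈ+cxᵉ : ∀ d e → e < d → Carrier → Monic d
  xᵈ+cxᵉ (suc d) zero    e<d       c = c , xᵈ d
  xᵈ+cxᵉ (suc d) (suc e) (s≤s e<d) c = 0# , xᵈ+cxᵉ d e e<d c

  eval-xᵈ+cxᵉ : ∀ d e (e<d : e < d) c x → eval (xᵈ+cxᵉ d e e<d c) x ≡ x ^ d + c * x ^ e
  eval-xᵈ+cxᵉ (suc d) zero    e<d       c x = begin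
    c + x * eval (xᵈ d) x       ≡⟨ cong (λ z → c + x * z) (eval-xᵈ d x) ⟩
    c + x * x ^ d               ≡⟨ +-comm c _ ⟩
    x * x ^ d + c               ≡⟨ cong (x * x ^ d +_) (*-identityʳ c) ⟨
    x * x ^ d + c * 1#          ∎
    where open ≡-Reasoning
  eval-xᵈ+cxᵉ (suc d) (suc e) (s≤s e<d) c x = begin
    0# + x * eval (xᵈ+cxᵉ d e e<d c) x   ≡⟨ +-identityˡ _ ⟩
    x * eval (xᵈ+cxᵉ d e e<d c) x        ≡⟨ cong (x *_) (eval-xᵈ+cxᵉ d e e<d c x) ⟩
    x * (x ^ d + c * x ^ e)
      ≡⟨ solve 4 (λ x u c v → x :* (u :+ c :* v) := x :* u :+ c :* (x :* v)) refl x (x ^ d) c (x ^ e) ⟩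
    x * x ^ d + c * (x * x ^ e)          ∎
    where open ≡-Reasoning

  count-roots-xᵈ+cxᵉ : ∀ {d e} → e < d → ∀ c → count (λ x → x ^ d + c * x ^ e ≟ 0#) ≤ d
  count-roots-xᵈ+cxᵉ {d} {e} e<d c = ℕₚ.≤-trans
    (ℕₚ.≤-reflexive (count-cong (λ x → x ^ d + c * x ^ e ≟ 0#) (root? P)
                               ((λ {x} → trans (eval-xᵈ+cxᵉ d e e<d c x)) , (λ {x} → trans (sym (eval-xᵈ+cxᵉ d e e<d c x))))))
    (count-roots P)
    where P = xᵈ+cxᵉ d e e<d c

  count-xᵈ≡xᵉ : ∀ {d e} → e < d → count (λ x → x ^ d ≟ x ^ e) ≤ d
  count-xᵈ≡xᵉ {d} {e} e<d = ℕₚ.≤-trans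
    (ℕₚ.≤-reflexive (count-cong (λ x → x ^ d ≟ x ^ e) (λ x → x ^ d + - 1# * x ^ e ≟ 0#)
                               ((λ {x} → xᵈ≡xᵉ⇒root {x}) , (λ {x} → root⇒xᵈ≡xᵉ {x}))))
    (count-roots-xᵈ+cxᵉ e<d (- 1#))
    where
    xᵈ≡xᵉ⇒root : ∀ {x} → x ^ d ≡ x ^ e → x ^ d + - 1# * x ^ e ≡ 0#
    xᵈ≡xᵉ⇒root {x} eq = trans (cong₂ (λ u v → u + v) eq (-1*x≈-x (x ^ e))) (-‿inverseʳ (x ^ e))
    root⇒xᵈ≡xᵉ : ∀ {x} → x ^ d + - 1# * x ^ e ≡ 0# → x ^ d ≡ x ^ e
    root⇒xᵈ≡xᵉ {x} eq = x∙y⁻¹≈ε⇒x≈y (x ^ d) (x ^ e) (trans (cong (x ^ d +_) (sym (-1*x≈-x (x ^ e)))) eq)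

module FibreCounting {m : ℕ} (F : FiniteField m) where

  open import Data.Nat.Base using (_<_)
  import Data.Nat.Properties as ℕₚ
  open import Data.Product.Base using (_,_; proj₁; proj₂)
  open import Data.Unit.Base using (tt)
  open import Function.Base using (_∘_)
  open import Relation.Unary using (Pred; Decidable)
  open import Relation.Unary.Properties using (U?; _∩?_)
  open import Relation.Binary.PropositionalEquality
    using (_≡_; refl; sym; trans; cong; module ≡-Reasoning)
  open import Level using (0ℓ)
  open Field F
  open MonicPolynomial F using (count-xᵈ≡xᵉ)

  module Additive (h : Carrier → Carrier) (h-+ : ∀ x y → h (x + y) ≡ h x + h y) where

    open Fibres h U? public

    count-fibre : ∀ z → Image z → count (fibre? z) ≡ count (fibre? 0#)
    count-fibre z (x₀ , _ , hx₀≡z) = count-permute (fibre? z) (fibre? 0#) (+-↔ x₀) (shifted⇒kernel , kernel⇒shifted)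
      where
      open ≡-Reasoning
      shifted⇒kernel : ∀ {x} → Fibre z (x + x₀) → Fibre 0# x
      shifted⇒kernel {x} (_ , h[x+x₀]≡z) = tt , +-cancelʳ (h x₀) (h x) 0# (begin
        h x + h x₀     ≡⟨ h-+ x x₀ ⟨
        h (x + x₀)     ≡⟨ h[x+x₀]≡z ⟩
        z              ≡⟨ hx₀≡z ⟨
        h x₀           ≡⟨ +-identityˡ (h x₀) ⟨
        0# + h x₀      ∎)
      kernel⇒shifted : ∀ {x} → Fibre 0# x → Fibre z (x + x₀)
      kernel⇒shifted {x} (_ , hx≡0) = tt , (begin
        h (x + x₀)     ≡⟨ h-+ x x₀ ⟩
        h x + h x₀     ≡⟨ cong (_+ h x₀) hx≡0 ⟩
        0# + h x₀      ≡⟨ +-identityˡ (h x₀) ⟩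
        h x₀           ≡⟨ hx₀≡z ⟩
        z              ∎)

    count-preimage : ∀ {P : Pred Carrier 0ℓ} (P? : Decidable P) →
                     count (U? ∩? (P? ∘ h)) ≡ count (fibre? 0#) ℕ.* count (P? ∩? image?)
    count-preimage = count-uniform-fibres _ count-fibre

  module Power (s : ℕ) .{{_ : ℕ.NonZero s}} where

    open Fibres (_^ s) nonZero? public

    count-fibre : ∀ z → Image z → count (fibre? z) ≡ count (fibre? 1#)
    count-fibre z (x₀ , x₀≢0 , x₀ˢ≡z) = count-permute (fibre? z) (fibre? 1#) (*-↔ x₀≢0) (scaled⇒kernel , kernel⇒scaled)
      where
      open ≡-Reasoning
      scaled⇒kernel : ∀ {x} → Fibre z (x * x₀) → Fibre 1# x
      scaled⇒kernel {x} (xx₀≢0 , [xx₀]ˢ≡z) = (λ x≡0 → xx₀≢0 (trans (cong (_* x₀) x≡0) (zeroˡ x₀))) , *-cancelʳ (^-≢0 s x₀≢0) (begin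
        x ^ s * x₀ ^ s   ≡⟨ ^-distrib-* x x₀ s ⟨
        (x * x₀) ^ s     ≡⟨ [xx₀]ˢ≡z ⟩
        z                ≡⟨ x₀ˢ≡z ⟨
        x₀ ^ s           ≡⟨ *-identityˡ _ ⟨
        1# * x₀ ^ s      ∎)
      kernel⇒scaled : ∀ {x} → Fibre 1# x → Fibre z (x * x₀)
      kernel⇒scaled {x} (x≢0 , xˢ≡1) = *-≢0 x≢0 x₀≢0 , (begin
        (x * x₀) ^ s     ≡⟨ ^-distrib-* x x₀ s ⟩
        x ^ s * x₀ ^ s   ≡⟨ cong (_* x₀ ^ s) xˢ≡1 ⟩
        1# * x₀ ^ s      ≡⟨ *-identityˡ _ ⟩
        x₀ ^ s           ≡⟨ x₀ˢ≡z ⟩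
        z                ∎)

    count-nonZero : count nonZero? ≡ count (fibre? 1#) ℕ.* count image?
    count-nonZero = begin
      count nonZero?                             ≡⟨ count-cong nonZero? (nonZero? ∩? (U? ∘ (_^ s))) ((_, tt) , proj₁) ⟩
      count (nonZero? ∩? (U? ∘ (_^ s)))          ≡⟨ count-uniform-fibres _ count-fibre U? ⟩
      count (fibre? 1#) ℕ.* count (U? ∩? image?)
        ≡⟨ cong (count (fibre? 1#) ℕ.*_) (count-cong (U? ∩? image?) image? (proj₂ , (tt ,_))) ⟩
      count (fibre? 1#) ℕ.* count image?           ∎
      where open ≡-Reasoning

    surjective : ∀ M → 0 < M → count (fibre? 1#) ≡ s → count nonZero? ≡ s ℕ.* M →
                 ∀ {w} → w ^ M ≡ 1# → Image w
    surjective M 0<M fibre≡s nonZero≡sM = count-≤⇒⊇ image? (λ w → w ^ M ≟ 1#) image⊆roots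
                                            (ℕₚ.≤-trans (count-xᵈ≡xᵉ 0<M) (ℕₚ.≤-reflexive (sym count-image)))
      where
      count-image : count image? ≡ M
      count-image = ℕₚ.*-cancelˡ-≡ _ _ s (trans (sym (trans count-nonZero (cong (ℕ._* count image?) fibre≡s))) nonZero≡sM)
      image⊆roots : ∀ {w} → Image w → w ^ M ≡ 1#
      image⊆roots (x , x≢0 , refl) = trans (^-assocʳ x s M) (trans (cong (x ^_) (sym nonZero≡sM)) (^-count-nonZero x≢0))

module Embedding {m m' : ℕ} {K : FiniteField m} {L : FiniteField m'} (e : FieldEmbedding K L) where

  open import Data.Nat.Base using (zero; suc; _<_)
  import Data.Nat.Properties as ℕₚ
  open import Data.Product.Base using (∃; _,_)
  open import Function.Base using (_∘_)
  open import Relation.Unary using (Pred; Decidable; _≐_)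
  open import Relation.Binary.PropositionalEquality
    using (_≡_; refl; sym; trans; cong; module ≡-Reasoning)
  open import Level using (0ℓ)
  module K = Field K
  open Field L
  open MonicPolynomial L using (count-xᵈ≡xᵉ)
  open FieldEmbedding e public using (ι; ι-+; ι-*; ι-1; ι-inj)

  ι-0 : ι K.0# ≡ 0#
  ι-0 = +-cancelʳ (ι K.0#) (ι K.0#) 0# (begin
    ι K.0# + ι K.0#      ≡⟨ ι-+ K.0# K.0# ⟨
    ι (K.0# K.+ K.0#)    ≡⟨ cong ι (K.+-identityˡ K.0#) ⟩
    ι K.0#               ≡⟨ +-identityˡ _ ⟨
    0# + ι K.0#          ∎)
    where open ≡-Reasoning

  ι-neg : ∀ x → ι (K.- x) ≡ - ι x
  ι-neg x = +-inverseʳ-unique (ι x) (ι (K.- x)) (trans (sym (ι-+ x (K.- x))) (trans (cong ι (K.-‿inverseʳ x)) ι-0))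

  ι-^ : ∀ x k → ι (x K.^ k) ≡ ι x ^ k
  ι-^ x zero    = ι-1
  ι-^ x (suc k) = trans (ι-* x (x K.^ k)) (cong (ι x *_) (ι-^ x k))

  InImage : Pred Carrier 0ℓ
  InImage y = ∃ λ x → ι x ≡ y

  inImage? : Decidable InImage
  inImage? y = K.∃? (λ x → ι x ≟ y)

  count-inImage : count inImage? ≡ m
  count-inImage = trans (count-cong inImage? (range? (ι ∘ K.from)) (InImage⊆Range , Range⊆InImage))
                        (count-range (ι ∘ K.from) ι∘from-injective)
    where
    ι∘from-injective : ∀ {i j} → ι (K.from i) ≡ ι (K.from j) → i ≡ j
    ι∘from-injective {i} {j} eq = trans (sym (K.to∘from i)) (trans (cong K.to (ι-inj _ _ eq)) (K.to∘from j))
    InImage⊆Range : ∀ {y} → InImage y → Range (ι ∘ K.from) y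
    InImage⊆Range (x , refl) = K.to x , cong ι (K.from∘to x)
    Range⊆InImage : ∀ {y} → Range (ι ∘ K.from) y → InImage y
    Range⊆InImage (i , eq) = K.from i , eq

  fixed⇔inImage : 1 < m → (λ y → y ^ m ≡ y) ≐ InImage
  fixed⇔inImage 1<m = count-≤⇒⊇ inImage? (λ y → y ^ m ≟ y) inImage⇒fixed count-fixed≤ , inImage⇒fixed
    where
    inImage⇒fixed : ∀ {y} → InImage y → y ^ m ≡ y
    inImage⇒fixed (x , refl) = trans (sym (ι-^ x m)) (cong ι (K.^-size x))
    count-fixed≤ : count (λ y → y ^ m ≟ y) ℕ.≤ count inImage?
    count-fixed≤ = begin
      count (λ y → y ^ m ≟ y)        ≡⟨ count-cong (λ y → y ^ m ≟ y) (λ y → y ^ m ≟ y ^ 1) (y≡y¹ , y¹≡y) ⟩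
      count (λ y → y ^ m ≟ y ^ 1)    ≤⟨ count-xᵈ≡xᵉ 1<m ⟩
      m                              ≡⟨ count-inImage ⟨
      count inImage?                 ∎
      where
      open ℕₚ.≤-Reasoning
      y≡y¹ : ∀ {y} → y ^ m ≡ y → y ^ m ≡ y ^ 1
      y≡y¹ {y} eq = trans eq (sym (*-identityʳ y))
      y¹≡y : ∀ {y} → y ^ m ≡ y ^ 1 → y ^ m ≡ y
      y¹≡y {y} eq = trans eq (*-identityʳ y)

module GeometricSeries (s : ℕ) where

  open import Data.Nat.Base using (zero; suc; _*_; _^_)
  import Data.Nat.Properties as ℕₚ
  open import Data.Nat.Solver using (module +-*-Solver)
  open import Relation.Binary.PropositionalEquality using (_≡_; refl; cong; cong₂; module ≡-Reasoning)
  open +-*-Solver using (solve; _:=_; _:+_; _:*_; con)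
  open ≡-Reasoning

  geometric : ℕ → ℕ
  geometric zero    = 0
  geometric (suc k) = suc (suc s * geometric k)

  s*geometric+1≡p^k : ∀ k → suc (s * geometric k) ≡ suc s ^ k
  s*geometric+1≡p^k zero    = cong suc (ℕₚ.*-zeroʳ s)
  s*geometric+1≡p^k (suc k) = begin
    suc (s * suc (suc s * geometric k))     ≡⟨ solve 2 (λ s g → con 1 :+ s :* (con 1 :+ (con 1 :+ s) :* g)
                                                              := (con 1 :+ s) :* (con 1 :+ s :* g)) refl s (geometric k) ⟩
    suc s * suc (s * geometric k)           ≡⟨ cong (suc s *_) (s*geometric+1≡p^k k) ⟩
    suc s * suc s ^ k                       ∎

  p^k*p^k≡1+s*geometric*[1+p^k] : ∀ k → suc s ^ k * suc s ^ k ≡ suc (s * (geometric k * suc (suc s ^ k)))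
  p^k*p^k≡1+s*geometric*[1+p^k] k = begin
    suc s ^ k * suc s ^ k                              ≡⟨ cong₂ _*_ (s*geometric+1≡p^k k) (s*geometric+1≡p^k k) ⟨
    suc (s * geometric k) * suc (s * geometric k)      ≡⟨ solve 2 (λ s g → (con 1 :+ s :* g) :* (con 1 :+ s :* g)
                                                                := con 1 :+ s :* (g :* (con 2 :+ s :* g))) refl s (geometric k) ⟩
    suc (s * (geometric k * suc (suc (s * geometric k)))) ≡⟨ cong (λ t → suc (s * (geometric k * suc t))) (s*geometric+1≡p^k k) ⟩
    suc (s * (geometric k * suc (suc s ^ k)))          ∎

module QuadraticExtension (s n : ℕ) (prime : Prime (suc s)) (1≤n : 1 ≤ n)
                          (K : FiniteField (suc s ℕ.^ n)) (L : FiniteField ((suc s ℕ.^ n) ℕ.^ 2))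
                          (e : FieldEmbedding K L) where

  open import Data.Nat.Base using (zero; suc; z≤n; s≤s)
  import Data.Nat.Properties as ℕₚ
  open import Data.Nat.DivMod using (m*n/n≡m)
  open import Data.Product.Base using (Σ; ∃; _,_; proj₁; proj₂)
  open import Data.Unit.Base using (tt)
  open import Data.Sum.Base using (inj₁; inj₂)
  open import Data.Empty using (⊥-elim)
  open import Data.Fin.Base using (Fin; toℕ)
  import Data.Fin.Properties as Fin
  open import Function.Base using (_∘_)
  open import Function.Bundles using (_↔_)
  open import Level using (0ℓ)
  open import Relation.Nullary using (Dec; yes; no)
  import Relation.Nullary.Decidable as Dec
  open import Relation.Unary using (Pred; Decidable; U; _∩_; _≐_)
  open import Axiom.UniquenessOfIdentityProofs using (module Decidable⇒UIP)
  open import Relation.Unary.Properties using (U?; _∩?_)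
  open import Relation.Binary.PropositionalEquality
    using (_≡_; _≢_; refl; sym; trans; cong; cong₂; subst; module ≡-Reasoning)
  open Field L
  open MonicPolynomial L using (count-roots-xᵈ+cxᵉ; count-xᵈ≡xᵉ)
  open Embedding e using (ι; ι-1; ι-inj; ι-neg; ι-^; InImage; inImage?; count-inImage; fixed⇔inImage)
  open ≡-Reasoning
  module K = Field K

  p q : ℕ
  p = suc s
  q = p ℕ.^ n

  instance
    s≢0 : ℕ.NonZero s
    s≢0 = prime⇒p∸1≢0 prime

  q^2≡q*q : q ℕ.^ 2 ≡ q ℕ.* q
  q^2≡q*q = cong (q ℕ.*_) (ℕₚ.*-identityʳ q)

  1<q : 1 ℕ.< q
  1<q = ℕₚ.^-monoʳ-< p (s≤s (ℕ.>-nonZero⁻¹ s)) 1≤n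

  open Characteristic s prime (size≡p^k⇒p×1≡0 p (n ℕ.* 2) (ℕₚ.^-*-assoc p n 2)) hiding (p)

  ^q-+ : ∀ x y → (x + y) ^ q ≡ x ^ q + y ^ q
  ^q-+ = frobeniusᵏ-+ n

  ^q-neg : ∀ x → (- x) ^ q ≡ - x ^ q
  ^q-neg = frobeniusᵏ-neg n

  ^q^q : ∀ x → (x ^ q) ^ q ≡ x
  ^q^q x = trans (^-assocʳ x q q) (trans (cong (x ^_) (sym q^2≡q*q)) (^-size x))

  ℘ : Carrier → Carrier
  ℘ x = x ^ q - x

  ℘-+ : ∀ x y → ℘ (x + y) ≡ ℘ x + ℘ y
  ℘-+ x y = begin
    (x + y) ^ q - (x + y)          ≡⟨ cong (_- (x + y)) (^q-+ x y) ⟩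
    (x ^ q + y ^ q) - (x + y)      ≡⟨ solve 4 (λ a b x y → a :+ b :- (x :+ y) := a :- x :+ (b :- y)) refl (x ^ q) (y ^ q) x y ⟩
    (x ^ q - x) + (y ^ q - y)      ∎

  module ℘ = FibreCounting.Additive L ℘ ℘-+

  ker℘≐K : ℘.Fibre 0# ≐ InImage
  ker℘≐K = (λ (_ , ℘x≡0) → proj₁ (fixed⇔inImage 1<q) (x∙y⁻¹≈ε⇒x≈y _ _ ℘x≡0))
          , (λ {x} x∈K → tt , trans (cong (_- x) (proj₂ (fixed⇔inImage 1<q) x∈K)) (-‿inverseʳ x))

  count-ker℘ : count (℘.fibre? 0#) ≡ q
  count-ker℘ = trans (count-cong (℘.fibre? 0#) inImage? ker℘≐K) count-inImage

  count-image℘ : count ℘.image? ≡ q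
  count-image℘ = ℕₚ.*-cancelˡ-≡ _ _ q {{ℕₚ.m^n≢0 p n}} (begin
    q ℕ.* count ℘.image?
      ≡⟨ cong₂ ℕ._*_ count-ker℘ (count-cong (U? ∩? ℘.image?) ℘.image? (proj₂ , (tt ,_))) ⟨
    count (℘.fibre? 0#) ℕ.* count (U? ∩? ℘.image?) ≡⟨ ℘.count-preimage U? ⟨
    count (U? ∩? (U? ∘ ℘))                         ≡⟨ count-universal (U? ∩? (U? ∘ ℘)) (λ _ → tt , tt) ⟩
    q ℕ.^ 2                                        ≡⟨ q^2≡q*q ⟩
    q ℕ.* q                                        ∎)

  image℘≐anti-fixed : ℘.Image ≐ (λ z → z ^ q + z ≡ 0#)
  image℘≐anti-fixed = image⊆anti-fixed
                    , count-≤⇒⊇ ℘.image? (λ z → z ^ q + z ≟ 0#) image⊆anti-fixed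
                                (ℕₚ.≤-trans count-anti-fixed≤ (ℕₚ.≤-reflexive (sym count-image℘)))
    where
    image⊆anti-fixed : ∀ {z} → ℘.Image z → z ^ q + z ≡ 0#
    image⊆anti-fixed (x , _ , refl) = begin
      (x ^ q - x) ^ q + (x ^ q - x)        ≡⟨ cong (_+ (x ^ q - x)) (trans (^q-+ (x ^ q) (- x)) (cong₂ _+_ (^q^q x) (^q-neg x))) ⟩
      (x - x ^ q) + (x ^ q - x)            ≡⟨ solve 2 (λ x y → x :- y :+ (y :- x) := x :- x) refl x (x ^ q) ⟩
      x - x                                ≡⟨ -‿inverseʳ x ⟩
      0#                                   ∎
    count-anti-fixed≤ : count (λ z → z ^ q + z ≟ 0#) ℕ.≤ q
    count-anti-fixed≤ = ℕₚ.≤-trans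
      (ℕₚ.≤-reflexive (count-cong (λ z → z ^ q + z ≟ 0#) (λ z → z ^ q + 1# * z ^ 1 ≟ 0#) (expand , contract)))
      (count-roots-xᵈ+cxᵉ 1<q 1#)
      where
      1*z¹≡z : ∀ z → 1# * z ^ 1 ≡ z
      1*z¹≡z z = trans (*-identityˡ _) (*-identityʳ z)
      expand : ∀ {z} → z ^ q + z ≡ 0# → z ^ q + 1# * z ^ 1 ≡ 0#
      expand {z} = trans (cong (z ^ q +_) (1*z¹≡z z))
      contract : ∀ {z} → z ^ q + 1# * z ^ 1 ≡ 0# → z ^ q + z ≡ 0#
      contract {z} = trans (cong (z ^ q +_) (sym (1*z¹≡z z)))

  module Solutions (b : K.Carrier) (norm : K.pow b (normExp p n prime) ≡ K.pow (K.- K.1#) (suc n)) where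

    open GeometricSeries s using (geometric; s*geometric+1≡p^k; p^k*p^k≡1+s*geometric*[1+p^k])

    β : Carrier
    β = ι b

    f : Carrier → Carrier
    f x = x ^ p + β * x

    N : ℕ
    N = geometric n

    normExp≡N : normExp p n prime ≡ N
    normExp≡N = begin
      (q ℕ.∸ 1) ℕ./ s                 ≡⟨ cong (λ k → (k ℕ.∸ 1) ℕ./ s) (s*geometric+1≡p^k n) ⟨
      (s ℕ.* N) ℕ./ s                 ≡⟨ cong (ℕ._/ s) (ℕₚ.*-comm s N) ⟩
      (N ℕ.* s) ℕ./ s                 ≡⟨ m*n/n≡m N s ⟩
      N                               ∎

    q≡1+sN : q ≡ suc (s ℕ.* N)
    q≡1+sN = sym (s*geometric+1≡p^k n)

    β^q≡β : β ^ q ≡ β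
    β^q≡β = proj₂ (fixed⇔inImage 1<q) (b , refl)

    ℘∘f≡f∘℘ : ∀ x → ℘ (f x) ≡ f (℘ x)
    ℘∘f≡f∘℘ x = begin
      (x ^ p + β * x) ^ q - (x ^ p + β * x)
        ≡⟨ cong (_- (x ^ p + β * x)) (trans (^q-+ (x ^ p) (β * x)) (cong₂ _+_ xᵖ^q (^-distrib-* β x q))) ⟩
      ((x ^ q) ^ p + β ^ q * x ^ q) - (x ^ p + β * x)    ≡⟨ cong (λ c → ((x ^ q) ^ p + c * x ^ q) - (x ^ p + β * x)) β^q≡β ⟩
      ((x ^ q) ^ p + β * x ^ q) - (x ^ p + β * x)
        ≡⟨ solve 5 (λ a u v b x → a :+ b :* u :- (v :+ b :* x) := a :- v :+ b :* (u :- x))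
                                                                 refl ((x ^ q) ^ p) (x ^ q) (x ^ p) β x ⟩
      ((x ^ q) ^ p - x ^ p) + β * (x ^ q - x)
        ≡⟨ cong (_+ β * (x ^ q - x)) (trans (frobenius-+ (x ^ q) (- x)) (cong ((x ^ q) ^ p +_) (frobenius-neg x))) ⟨
      (x ^ q - x) ^ p + β * (x ^ q - x)                   ∎
      where
      xᵖ^q : (x ^ p) ^ q ≡ (x ^ q) ^ p
      xᵖ^q = trans (^-assocʳ x p q) (trans (cong (x ^_) (ℕₚ.*-comm p q)) (sym (^-assocʳ x q p)))

    [-1]^p≡-1 : (- 1#) ^ p ≡ - 1#
    [-1]^p≡-1 = trans (frobenius-neg 1#) (cong -_ (1^n≡1 p))

    [-1]^geometric : ∀ k → (- 1#) ^ geometric k ≡ (- 1#) ^ k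
    [-1]^geometric zero    = refl
    [-1]^geometric (suc k) = cong (- 1# *_) (begin
      (- 1#) ^ (p ℕ.* geometric k)         ≡⟨ ^-assocʳ (- 1#) p (geometric k) ⟨
      ((- 1#) ^ p) ^ geometric k           ≡⟨ cong (_^ geometric k) [-1]^p≡-1 ⟩
      (- 1#) ^ geometric k                 ≡⟨ [-1]^geometric k ⟩
      (- 1#) ^ k                           ∎)

    [-1]^k*[-1]^k≡1 : ∀ k → (- 1#) ^ k * (- 1#) ^ k ≡ 1#
    [-1]^k*[-1]^k≡1 k = begin
      (- 1#) ^ k * (- 1#) ^ k              ≡⟨ ^-distrib-* (- 1#) (- 1#) k ⟨
      (- 1# * - 1#) ^ k                    ≡⟨ cong (_^ k) (trans (-1*x≈-x (- 1#)) (-‿involutive 1#)) ⟩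
      1# ^ k                               ≡⟨ 1^n≡1 k ⟩
      1#                                   ∎

    β^N≡[-1]^[n+1] : β ^ N ≡ (- 1#) ^ suc n
    β^N≡[-1]^[n+1] = begin
      ι b ^ N                              ≡⟨ ι-^ b N ⟨
      ι (b K.^ N)                          ≡⟨ cong ι (trans (cong (b K.^_) (sym normExp≡N)) (sym (K.pow≗^ b (normExp p n prime)))) ⟩
      ι (K.pow b (normExp p n prime))      ≡⟨ cong ι norm ⟩
      ι (K.pow (K.- K.1#) (suc n))         ≡⟨ cong ι (K.pow≗^ (K.- K.1#) (suc n)) ⟩
      ι ((K.- K.1#) K.^ suc n)             ≡⟨ ι-^ (K.- K.1#) (suc n) ⟩
      ι (K.- K.1#) ^ suc n                 ≡⟨ cong (_^ suc n) (trans (ι-neg K.1#) (cong -_ ι-1)) ⟩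
      (- 1#) ^ suc n                       ∎

    [-β]^N≡-1 : (- β) ^ N ≡ - 1#
    [-β]^N≡-1 = begin
      (- β) ^ N                            ≡⟨ cong (_^ N) (-1*x≈-x β) ⟨
      (- 1# * β) ^ N                       ≡⟨ ^-distrib-* (- 1#) β N ⟩
      (- 1#) ^ N * β ^ N                   ≡⟨ cong₂ _*_ ([-1]^geometric n) β^N≡[-1]^[n+1] ⟩
      (- 1#) ^ n * (- 1# * (- 1#) ^ n)     ≡⟨ solve 2 (λ a u → u :* (a :* u) := a :* (u :* u)) refl (- 1#) ((- 1#) ^ n) ⟩
      - 1# * ((- 1#) ^ n * (- 1#) ^ n)     ≡⟨ cong (- 1# *_) ([-1]^k*[-1]^k≡1 n) ⟩
      - 1# * 1#                            ≡⟨ *-identityʳ (- 1#) ⟩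
      - 1#                                 ∎

    ker-f⇒zˢ≡-β : ∀ {z} → z ≢ 0# → f z ≡ 0# → z ^ s ≡ - β
    ker-f⇒zˢ≡-β {z} z≢0 fz≡0 with zero-product (trans (solve 3 (λ z u b → z :* (u :+ b) := z :* u :+ b :* z) refl z (z ^ s) β) fz≡0)
    ... | inj₁ z≡0     = ⊥-elim (z≢0 z≡0)
    ... | inj₂ zˢ+β≡0 = +-inverseʳ-unique β (z ^ s) (trans (+-comm β _) zˢ+β≡0)

    ker-f⊆anti-fixed : ∀ {z} → f z ≡ 0# → z ^ q + z ≡ 0#
    ker-f⊆anti-fixed {z} fz≡0 with z ≟ 0#
    ... | yes refl = trans (+-identityʳ _) (trans (cong (0# ^_) q≡1+sN) (zeroˡ _))
    ... | no  z≢0  = trans (cong (_+ z) zᵠ≡-z) (-‿inverseˡ z)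
      where
      zᵠ≡-z : z ^ q ≡ - z
      zᵠ≡-z = begin
        z ^ q                      ≡⟨ cong (z ^_) q≡1+sN ⟩
        z * z ^ (s ℕ.* N)          ≡⟨ cong (z *_) (^-assocʳ z s N) ⟨
        z * (z ^ s) ^ N            ≡⟨ cong (λ w → z * w ^ N) (ker-f⇒zˢ≡-β z≢0 fz≡0) ⟩
        z * (- β) ^ N              ≡⟨ cong (z *_) [-β]^N≡-1 ⟩
        z * - 1#                   ≡⟨ trans (*-comm z (- 1#)) (-1*x≈-x z) ⟩
        - z                        ∎

    module Power = FibreCounting.Power L s

    -- M = (q² - 1) / s, so that the s-th powers of nonzero elements are exactly the roots of w ^ M = 1.
    M : ℕ
    M = N ℕ.* suc q

    count-nonZero≡s*M : count nonZero? ≡ s ℕ.* M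
    count-nonZero≡s*M = ℕₚ.suc-injective (trans suc-count-nonZero (trans q^2≡q*q (p^k*p^k≡1+s*geometric*[1+p^k] n)))

    count-unit-roots : count (Power.fibre? 1#) ≡ s
    count-unit-roots = ℕₚ.≤-antisym
      (ℕₚ.≤-trans (count-mono (Power.fibre? 1#) (λ x → x ^ s ≟ x ^ 0) proj₂) (count-xᵈ≡xᵉ (ℕ.>-nonZero⁻¹ s)))
      (ℕₚ.≤-trans (ℕₚ.≤-reflexive (sym (count-range element element-injective)))
                  (count-mono (range? element) (Power.fibre? 1#) (λ { (i , refl) → element-unit-root i })))
      where
      element : Fin s → Carrier
      element i = suc (toℕ i) × 1#
      element-injective : ∀ {i j} → element i ≡ element j → i ≡ j
      element-injective eq = Fin.toℕ-injective (ℕₚ.suc-injective (×1-injective (s≤s (Fin.toℕ<n _)) (s≤s (Fin.toℕ<n _)) eq))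
      element-unit-root : ∀ i → Power.Fibre 1# (element i)
      element-unit-root i = element≢0 , *-cancelʳ element≢0 (trans (*-comm _ _) (trans (×1-^p (suc (toℕ i))) (sym (*-identityˡ _))))
        where
        element≢0 : element i ≢ 0#
        element≢0 = ×1-≢0 (s≤s z≤n) (s≤s (Fin.toℕ<n i))

    [-β]^M≡1 : (- β) ^ M ≡ 1#
    [-β]^M≡1 = begin
      (- β) ^ (N ℕ.* suc q)          ≡⟨ ^-assocʳ (- β) N (suc q) ⟨
      ((- β) ^ N) ^ suc q            ≡⟨ cong (_^ suc q) [-β]^N≡-1 ⟩
      - 1# * (- 1#) ^ q              ≡⟨ cong (- 1# *_) (trans (^q-neg 1#) (cong -_ (1^n≡1 q))) ⟩
      - 1# * - 1#                    ≡⟨ trans (-1*x≈-x (- 1#)) (-‿involutive 1#) ⟩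
      1#                             ∎

    0<M : 0 ℕ.< M
    0<M = ℕₚ.*-mono-< (geometric-positive n 1≤n) (s≤s z≤n)
      where
      geometric-positive : ∀ k → 1 ≤ k → 0 ℕ.< geometric k
      geometric-positive (suc k) _ = s≤s z≤n

    s-th-root : Power.Image (- β)
    s-th-root = Power.surjective M 0<M count-unit-roots count-nonZero≡s*M [-β]^M≡1

    z₀ : Carrier
    z₀ = proj₁ s-th-root

    z₀≢0 : z₀ ≢ 0#
    z₀≢0 = proj₁ (proj₂ s-th-root)

    fz₀≡0 : f z₀ ≡ 0#
    fz₀≡0 = begin
      z₀ * z₀ ^ s + β * z₀            ≡⟨ cong (λ w → z₀ * w + β * z₀) (proj₂ (proj₂ s-th-root)) ⟩
      z₀ * - β + β * z₀               ≡⟨ solve 2 (λ z b → z :* :- b :+ b :* z := z :- z) refl z₀ β ⟩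
      z₀ - z₀                         ≡⟨ -‿inverseʳ z₀ ⟩
      0#                              ∎

    f? : ∀ x → Dec (f x ≡ 0#)
    f? x = f x ≟ 0#

    count-ker-f : count f? ≡ p
    count-ker-f = ℕₚ.≤-antisym
      (ℕₚ.≤-trans (count-mono f? (λ x → x ^ p + β * x ^ 1 ≟ 0#) (λ {x} → trans (cong (λ w → x ^ p + β * w) (*-identityʳ x))))
                  (count-roots-xᵈ+cxᵉ (s≤s (ℕ.>-nonZero⁻¹ s)) β))
      (ℕₚ.≤-trans (ℕₚ.≤-reflexive (sym (count-range element element-injective)))
                  (count-mono (range? element) f? (λ { (i , refl) → element-root i })))
      where
      element : Fin p → Carrier
      element i = (toℕ i × 1#) * z₀
      element-injective : ∀ {i j} → element i ≡ element j → i ≡ j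
      element-injective eq = Fin.toℕ-injective (×1-injective (Fin.toℕ<n _) (Fin.toℕ<n _) (*-cancelʳ z₀≢0 eq))
      element-root : ∀ i → f (element i) ≡ 0#
      element-root i = begin
        ((c * z₀) ^ p + β * (c * z₀))
          ≡⟨ cong (_+ β * (c * z₀)) (trans (^-distrib-* c z₀ p) (cong (_* z₀ ^ p) (×1-^p (toℕ i)))) ⟩
        c * z₀ ^ p + β * (c * z₀)
          ≡⟨ solve 4 (λ c a b z → c :* a :+ b :* (c :* z) := c :* (a :+ b :* z)) refl c (z₀ ^ p) β z₀ ⟩
        c * f z₀                             ≡⟨ cong (c *_) fz₀≡0 ⟩
        c * 0#                               ≡⟨ zeroʳ c ⟩
        0#                                   ∎
        where
        c : Carrier
        c = toℕ i × 1#

    Solution : Pred Carrier 0ℓ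
    Solution x = ∃ λ y → pow x p + β * x ≡ ι y

    solution? : Decidable Solution
    solution? x = Dec.map′ (λ (y , ιy≡) → y , sym ιy≡) (λ (y , ≡ιy) → y , sym ≡ιy) (inImage? (pow x p + β * x))

    Solution≐ker-f∘℘ : Solution ≐ (U ∩ (λ x → f (℘ x) ≡ 0#))
    Solution≐ker-f∘℘ =
        (λ {x} (y , eq) → tt , trans (sym (℘∘f≡f∘℘ x)) (proj₂ (proj₂ ker℘≐K (y , trans (sym eq) (fx≡ x)))))
      , (λ {x} (_ , f℘x≡0) → let (y , ιy≡fx) = proj₁ ker℘≐K (tt , trans (℘∘f≡f∘℘ x) f℘x≡0)
                             in y , trans (fx≡ x) (sym ιy≡fx))
      where
      fx≡ : ∀ x → pow x p + β * x ≡ f x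
      fx≡ x = cong (_+ β * x) (pow≗^ x p)

    count-solutions : count solution? ≡ p ℕ.^ suc n
    count-solutions = begin
      count solution?                           ≡⟨ count-cong solution? (U? ∩? (f? ∘ ℘)) Solution≐ker-f∘℘ ⟩
      count (U? ∩? (f? ∘ ℘))                    ≡⟨ ℘.count-preimage f? ⟩
      count (℘.fibre? 0#) ℕ.* count (f? ∩? ℘.image?)
        ≡⟨ cong₂ ℕ._*_ count-ker℘ (count-cong (f? ∩? ℘.image?) f? (proj₁ , ker-f⊆image℘)) ⟩
      q ℕ.* count f?                            ≡⟨ cong (q ℕ.*_) count-ker-f ⟩
      q ℕ.* p                                   ≡⟨ ℕₚ.*-comm q p ⟩
      p ℕ.^ suc n                               ∎
      where
      ker-f⊆image℘ : ∀ {x} → f x ≡ 0# → ((λ x → f x ≡ 0#) ∩ ℘.Image) x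
      ker-f⊆image℘ fx≡0 = fx≡0 , proj₂ image℘≐anti-fixed (ker-f⊆anti-fixed fx≡0)

    Solution-irrelevant : ∀ x (u v : Solution x) → u ≡ v
    Solution-irrelevant x (y₁ , e₁) (y₂ , e₂) with ι-inj y₁ y₂ (trans (sym e₁) e₂)
    ... | refl = cong (y₁ ,_) (Decidable⇒UIP.≡-irrelevant _≟_ e₁ e₂)

    solutions↔ : Σ Carrier Solution ↔ Fin (p ℕ.^ suc n)
    solutions↔ = subst (λ k → Σ Carrier Solution ↔ Fin k) count-solutions (Σ↔count solution? Solution-irrelevant)

open import Defs
open import Data.Nat using (ℕ; suc; _≥_; _^_)
open import Data.Nat.Primality using (Prime)
open import Data.Fin using (Fin)
open import Data.Product using (Σ; ∃)
open import Function.Bundles using (_↔_)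
open import Relation.Nullary using (¬_)
open import Relation.Binary.PropositionalEquality using (_≡_)

lemma2p4 : (p n : ℕ) → (pr : Prime p) → ¬ (p ≡ 2) → n ≥ 1
    → (K : FiniteField (p ^ n)) → (L : FiniteField ((p ^ n) ^ 2))
    → (e : FieldEmbedding K L)
    → (b : Carrier K) → ¬ (b ≡ 0# K)
    → pow K b (normExp p n pr) ≡ pow K (-_ K (1# K)) (suc n)
    → Σ (Carrier L) (λ x → ∃ λ y → _+_ L (pow L x p) (_*_ L (ι e b) x) ≡ ι e y)
    ↔ Fin (p ^ suc n)
lemma2p4 (suc s) n pr _ n≥1 K L e b _ norm = QuadraticExtension.Solutions.solutions↔ s n pr n≥1 K L e b norm
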